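{- Let $M$ be a nonempty finite set of pixels of the regular orthogonal grid in $\mathbb{R}^2$ that has no $0$-tunnels. Let $p$ be the number of pixels of $M$, $v$ the number of distinct grid points that are a vertex of at least one pixel of $M$, $h$ the number of holes of $M$, $c$ the number of connected components of $M$, and $b$ the number of 2-blocks of $M$. Then $v - 2(p + c - h) + b = 0$.
   Context: Pixels are the closed unit squares of $\mathbb{R}^2$ centered at the points of $\mathbb{Z}^2$; a pixel has four vertices. Two pixels are $0$-adjacent if they share a vertex and $1$-adjacent if they share an edge. A $k$-path ($k\in\{0,1\}$) is a sequence of pixels in which consecutive pixels are $k$-adjacent; the $k$-components of a set of pixels are its maximal $k$-connected subsets. The connected components counted by $c$ are the $0$-components of $M$. The holes counted by $h$ are the finite $1$-components of the set of all pixels not in $M$. A 2-block of $M$ is a $2\times 2$ square of four pixels all in $M$. A $0$-tunnel of $M$ is a grid point $x$ such that among the four pixels having $x$ as a vertex exactly two belong to $M$ and they are diagonally opposite ($0$-adjacent but not $1$-adjacent). -}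

module Defs where

open import Data.Nat using (ℕ; _≤_) renaming (_+_ to _+ℕ_)
open import Data.Integer using (ℤ; _-_; _+_; ∣_∣; +_)
open import Data.Product using (_×_; _,_; ∃)
open import Data.Sum using (_⊎_)
open import Data.List using (List; length)
open import Data.List.Membership.Propositional using (_∈_; _∉_)
open import Data.List.Relation.Unary.Unique.Propositional using (Unique)
open import Relation.Binary.PropositionalEquality using (_≡_; _≢_)
open import Relation.Nullary using (¬_)

-- A pixel is identified with its center, a point of ℤ².
Pixel : Set
Pixel = ℤ × ℤ

-- A grid point (vertex of pixels) (i + 1/2 , j + 1/2) is encoded by (i , j).
GridPoint : Set
GridPoint = ℤ × ℤ

-- The four vertices of the pixel centered at (x , y) are (x ± 1/2 , y ± 1/2),
-- i.e. the encoded grid points (x , y), (x - 1 , y), (x , y - 1), (x - 1 , y - 1).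
IsVertexOf : GridPoint → Pixel → Set
IsVertexOf (i , j) (x , y) = (i ≡ x ⊎ i ≡ x - + 1) × (j ≡ y ⊎ j ≡ y - + 1)

Adj0 : Pixel → Pixel → Set
Adj0 (x₁ , y₁) (x₂ , y₂) = ((x₁ , y₁) ≢ (x₂ , y₂)) × (∣ x₁ - x₂ ∣ ≤ 1) × (∣ y₁ - y₂ ∣ ≤ 1)

Adj1 : Pixel → Pixel → Set
Adj1 (x₁ , y₁) (x₂ , y₂) = ∣ x₁ - x₂ ∣ +ℕ ∣ y₁ - y₂ ∣ ≡ 1

data Path (Adj : Pixel → Pixel → Set) (S : Pixel → Set) : Pixel → Pixel → Set where
  single : ∀ {a} → S a → Path Adj S a a
  step   : ∀ {a b c} → S a → Adj a b → Path Adj S b c → Path Adj S a c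

InM : List Pixel → Pixel → Set
InM M q = q ∈ M

NotInM : List Pixel → Pixel → Set
NotInM M q = q ∉ M

Finite : (Pixel → Set) → Set
Finite P = ∃ λ (L : List Pixel) → ∀ q → P q → q ∈ L

-- L lists, without repetition, exactly the elements satisfying P;
-- so length L is the number of elements satisfying P.
Enumerates : {A : Set} → List A → (A → Set) → Set
Enumerates {A} L P = Unique L × (∀ x → (x ∈ L → P x) × (P x → x ∈ L))

-- Hence length R is the number of classes (components).
Transversal : (Pixel → Set) → (Pixel → Pixel → Set) → List Pixel → Set
Transversal D Conn R =
  Unique R
  × (∀ r → r ∈ R → D r)
  × (∀ r s → r ∈ R → s ∈ R → r ≢ s → ¬ Conn r s)
  × (∀ q → D q → ∃ λ r → r ∈ R × Conn q r)

Conn0 : List Pixel → Pixel → Pixel → Set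
Conn0 M = Path Adj0 (InM M)

Conn1c : List Pixel → Pixel → Pixel → Set
Conn1c M = Path Adj1 (NotInM M)

InFiniteHole : List Pixel → Pixel → Set
InFiniteHole M q = (q ∉ M) × Finite (Conn1c M q)

-- The grid point (i + 1/2 , j + 1/2) is surrounded by the pixels (i , j), (i + 1 , j),
-- (i , j + 1), (i + 1 , j + 1).
IsZeroTunnel : List Pixel → GridPoint → Set
IsZeroTunnel M (i , j) =
  ((i , j) ∈ M × (i + + 1 , j + + 1) ∈ M × (i + + 1 , j) ∉ M × (i , j + + 1) ∉ M)
  ⊎ ((i + + 1 , j) ∈ M × (i , j + + 1) ∈ M × (i , j) ∉ M × (i + + 1 , j + + 1) ∉ M)

-- A 2-block, identified by its lower-left pixel (x , y).
Is2Block : List Pixel → Pixel → Set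
Is2Block M (x , y) =
  (x , y) ∈ M × (x + + 1 , y) ∈ M × (x , y + + 1) ∈ M × (x + + 1 , y + + 1) ∈ M

IsVertexOfM : List Pixel → GridPoint → Set
IsVertexOfM M w = ∃ λ q → q ∈ M × IsVertexOf w q

module Submission where

-- Let Ê(X) be the sum, over all grid points, of a weight depending on the four pixels around the
-- point, chosen so that Ê(X) = 4(v − 2p + b) − 4t where t counts the 0-tunnels of X.
-- Removing the lexicographically largest pixel q of X changes Ê by 8, 0 or −8 according to which
-- of the west, south-west, south and south-east neighbours of q are present; in the case −8 either
-- a component of X splits or, by a crossing-parity (discrete Jordan curve) argument, the pixel south
-- of q lies in a hole of X that merges with the outside. By induction Ê(X) ≥ 8(c − h) for every
-- finite X.
-- For tunnel-free M let N be the complement of M in a box around it. The weights of M and N add up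
-- to that of the box, whose Ê is 8, and N has at least h + 1 components (the holes of M and the
-- outside) and at most c holes, so the lower bound for N gives Ê(M) ≤ 8(c − h). Hence
-- 4(v − 2p + b) = Ê(M) = 8(c − h).

open import Defs
open import Data.Nat using (ℕ)
open import Data.Integer using (ℤ; _-_; _+_; _*_; +_)
open import Data.List using (List; []; length)
open import Data.List.Membership.Propositional using (_∈_)
open import Data.List.Relation.Unary.Unique.Propositional using (Unique)
open import Relation.Binary.PropositionalEquality using (_≡_; _≢_)
open import Relation.Nullary using (¬_)

open import Data.Bool using (Bool; true; false; _∧_; _∨_; not; _xor_; T)
open import Data.Bool.Properties using (xor-same; xor-assoc; xor-comm; ∧-zeroʳ)
open import Data.Empty using (⊥; ⊥-elim)
open import Data.Integer using (-_; -[1+_]; ∣_∣; 0ℤ; 1ℤ; -1ℤ; _≤_; _<_; _⊓_; _⊔_; +≤+; +<+)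
open import Data.List using (_∷_; _++_; map; filter; filterᵇ; cartesianProduct)
open import Data.List.Membership.Propositional using (_∉_)
open import Data.List.Membership.Propositional.Properties
  using (∈-++⁺ˡ; ∈-++⁺ʳ; ∈-++⁻; ∈-∃++; ∈-insert; ∈-filter⁺; ∈-filter⁻;
         ∈-cartesianProduct⁺; ∈-cartesianProduct⁻; ∈-map⁺; ∈-map⁻)
open import Data.List.Relation.Binary.Subset.Propositional using (_⊆_)
open import Data.List.Relation.Unary.All as All using (All; []; _∷_)
open import Data.List.Properties using (length-++-sucʳ; length-map)
open import Data.List.Relation.Unary.AllPairs using ([]; _∷_)
open import Data.List.Relation.Unary.Any using (here; there)
import Data.List.Relation.Unary.Unique.Propositional.Properties as Unique
open import Data.Nat as ℕ using (zero; suc; z≤n; s≤s)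
import Data.Nat.Properties as ℕ
open import Data.Integer.Properties as ℤ using ()
open import Data.Integer.Solver using (module +-*-Solver)
open +-*-Solver using (solve; _:+_; _:-_; _:*_; _:=_; con)
open import Data.Product using (_×_; _,_; ∃; proj₁; proj₂)
open import Data.Product.Properties using (≡-dec)
open import Data.Sum using (_⊎_; inj₁; inj₂)
open import Data.Unit using (tt)
open import Data.Vec using (Vec) renaming ([] to []ᵛ; _∷_ to _∷ᵛ_)
open import Effect.Monad using (RawMonad)
open import Induction.WellFounded using (Acc; acc)
open import Level using (0ℓ)
import Data.Nat.Induction as ℕ
open import Relation.Binary using (DecidableEquality; tri<; tri≈; tri>)
open import Relation.Binary.PropositionalEquality using (refl; sym; trans; cong; cong₂; subst; subst₂; module ≡-Reasoning)
open import Relation.Nullary using (Dec; yes; no; does; ¬?; contradiction)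
open import Relation.Nullary.Decidable using (decidable-stable; dec-true; dec-false)
open import Relation.Nullary.Negation using (DoubleNegation; ¬¬-Monad)
open import Relation.Nullary.Decidable.Core using (¬¬-excluded-middle; T?)

open RawMonad (¬¬-Monad {a = 0ℓ}) using (pure; _>>=_)

_≟ᵖ_ : DecidableEquality Pixel
_≟ᵖ_ = ≡-dec ℤ._≟_ ℤ._≟_

open import Data.List.Membership.DecPropositional _≟ᵖ_ using (_∈?_)
open import Data.List.Membership.DecPropositional ℤ._≟_ using () renaming (_∈?_ to _∈ℤ?_)

module _ {Adj : Pixel → Pixel → Set} {S : Pixel → Set} where

  path-start : ∀ {a b} → Path Adj S a b → S a
  path-start (single s) = s
  path-start (step s _ _) = s

  path-end : ∀ {a b} → Path Adj S a b → S b
  path-end (single s) = s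
  path-end (step _ _ p) = path-end p

  infixr 5 _++ᵖ_

  _++ᵖ_ : ∀ {a b c} → Path Adj S a b → Path Adj S b c → Path Adj S a c
  single _ ++ᵖ q = q
  step s e p ++ᵖ q = step s e (p ++ᵖ q)

  path-snoc : ∀ {a b c} → Path Adj S a b → Adj b c → S c → Path Adj S a c
  path-snoc p e s = p ++ᵖ step (path-end p) e (single s)

  path-reverse : (∀ {u w} → Adj u w → Adj w u) → ∀ {a b} → Path Adj S a b → Path Adj S b a
  path-reverse sym-adj (single s) = single s
  path-reverse sym-adj (step s e p) = path-snoc (path-reverse sym-adj p) (sym-adj e) s

path-mono : ∀ {Adj S T a b} → (∀ z → S z → T z) → Path Adj S a b → Path Adj T a b
path-mono f (single s) = single (f _ s)
path-mono f (step s e p) = step (f _ s) e (path-mono f p)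

Near : ℤ → ℤ → Set
Near a b = (b ≡ a - 1ℤ) ⊎ (b ≡ a) ⊎ (b ≡ a + 1ℤ)

NearPixel : Pixel → Pixel → Set
NearPixel (ux , uy) (wx , wy) = Near ux wx × Near uy wy

near-refl : ∀ t → Near t t
near-refl t = inj₂ (inj₁ refl)

near-suc : ∀ t → Near t (t + 1ℤ)
near-suc t = inj₂ (inj₂ refl)

near-pred : ∀ t → Near t (t - 1ℤ)
near-pred t = inj₁ refl

i-1+1≡i : ∀ i → i - 1ℤ + 1ℤ ≡ i
i-1+1≡i = solve 1 (λ i → i :- con 1ℤ :+ con 1ℤ := i) refl

i+1-1≡i : ∀ i → i + 1ℤ - 1ℤ ≡ i
i+1-1≡i = solve 1 (λ i → i :+ con 1ℤ :- con 1ℤ := i) refl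

near-suc⁻ : ∀ t → Near (t + 1ℤ) t
near-suc⁻ t = inj₁ (sym (i+1-1≡i t))

i-j≡d⇒j≡i-d : ∀ i j d → i - j ≡ d → j ≡ i - d
i-j≡d⇒j≡i-d i j d refl = solve 2 (λ i j → j := i :- (i :- j)) refl i j

∣i-j∣≤1⇒near : ∀ i j → ∣ i - j ∣ ℕ.≤ 1 → Near i j
∣i-j∣≤1⇒near i j h with i - j in eq
... | + 0 = inj₂ (inj₁ (trans (i-j≡d⇒j≡i-d i j _ eq) (ℤ.+-identityʳ i)))
... | + 1 = inj₁ (i-j≡d⇒j≡i-d i j _ eq)
... | -[1+ 0 ] = inj₂ (inj₂ (trans (i-j≡d⇒j≡i-d i j _ eq) (solve 1 (λ i → i :- con -1ℤ := i :+ con 1ℤ) refl i)))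
... | + suc (suc _) = contradiction h λ { (s≤s ()) }
... | -[1+ suc _ ] = contradiction h λ { (s≤s ()) }

adj0⇒near : ∀ {u w} → Adj0 u w → NearPixel u w
adj0⇒near {x₁ , y₁} {x₂ , y₂} (_ , hx , hy) = ∣i-j∣≤1⇒near x₁ x₂ hx , ∣i-j∣≤1⇒near y₁ y₂ hy

∣i-j∣≡1⇒±1 : ∀ i j → ∣ i - j ∣ ≡ 1 → (j ≡ i + 1ℤ) ⊎ (j ≡ i - 1ℤ)
∣i-j∣≡1⇒±1 i j h with ∣i-j∣≤1⇒near i j (ℕ.≤-reflexive h)
... | inj₁ e = inj₂ e
... | inj₂ (inj₂ e) = inj₁ e
... | inj₂ (inj₁ refl) = contradiction (trans (sym h) (cong ∣_∣ (ℤ.+-inverseʳ i))) λ ()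

∣i-j∣≡0⇒j≡i : ∀ i j → ∣ i - j ∣ ≡ 0 → j ≡ i
∣i-j∣≡0⇒j≡i i j h = sym (ℤ.i-j≡0⇒i≡j i j (ℤ.∣i∣≡0⇒i≡0 h))

adj1-cases : ∀ {x₁ y₁ x₂ y₂} → Adj1 (x₁ , y₁) (x₂ , y₂) →
             (((x₂ ≡ x₁ + 1ℤ) ⊎ (x₂ ≡ x₁ - 1ℤ)) × y₂ ≡ y₁) ⊎ (x₂ ≡ x₁ × ((y₂ ≡ y₁ + 1ℤ) ⊎ (y₂ ≡ y₁ - 1ℤ)))
adj1-cases {x₁} {y₁} {x₂} {y₂} h with ∣ x₁ - x₂ ∣ in ex | ∣ y₁ - y₂ ∣ in ey
... | 0 | 1 = inj₂ (∣i-j∣≡0⇒j≡i x₁ x₂ ex , ∣i-j∣≡1⇒±1 y₁ y₂ ey)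
... | 1 | 0 = inj₁ (∣i-j∣≡1⇒±1 x₁ x₂ ex , ∣i-j∣≡0⇒j≡i y₁ y₂ ey)
... | 0 | 0 = contradiction h λ ()
... | 0 | suc (suc _) = contradiction h λ ()
... | 1 | suc _ = contradiction h λ ()
... | suc (suc _) | _ = contradiction h λ ()

adj0-sym : ∀ {u w} → Adj0 u w → Adj0 w u
adj0-sym {x₁ , y₁} {x₂ , y₂} (u≢w , hx , hy) =
  (λ e → u≢w (sym e)) , subst (ℕ._≤ 1) (ℤ.∣i-j∣≡∣j-i∣ x₁ x₂) hx , subst (ℕ._≤ 1) (ℤ.∣i-j∣≡∣j-i∣ y₁ y₂) hy

adj1-sym : ∀ {u w} → Adj1 u w → Adj1 w u
adj1-sym {x₁ , y₁} {x₂ , y₂} h = trans (cong₂ ℕ._+_ (ℤ.∣i-j∣≡∣j-i∣ x₂ x₁) (ℤ.∣i-j∣≡∣j-i∣ y₂ y₁)) h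

adj1⇒adj0 : ∀ {u w} → Adj1 u w → Adj0 u w
adj1⇒adj0 {x₁ , y₁} {x₂ , y₂} h =
  u≢w , subst (∣ x₁ - x₂ ∣ ℕ.≤_) h (ℕ.m≤m+n _ _) , subst (∣ y₁ - y₂ ∣ ℕ.≤_) h (ℕ.m≤n+m _ _)
  where
  u≢w : (x₁ , y₁) ≢ (x₂ , y₂)
  u≢w refl = contradiction (trans (sym h) (cong₂ ℕ._+_ (cong ∣_∣ (ℤ.+-inverseʳ x₁)) (cong ∣_∣ (ℤ.+-inverseʳ y₁)))) λ ()

adj1-right : ∀ x y → Adj1 (x , y) (x + 1ℤ , y)
adj1-right x y rewrite solve 1 (λ x → x :- (x :+ con 1ℤ) := con -1ℤ) refl x | ℤ.+-inverseʳ y = refl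

adj1-left : ∀ x y → Adj1 (x , y) (x - 1ℤ , y)
adj1-left x y rewrite solve 1 (λ x → x :- (x :- con 1ℤ) := con 1ℤ) refl x | ℤ.+-inverseʳ y = refl

adj1-up : ∀ x y → Adj1 (x , y) (x , y + 1ℤ)
adj1-up x y rewrite ℤ.+-inverseʳ x | solve 1 (λ y → y :- (y :+ con 1ℤ) := con -1ℤ) refl y = refl

adj1-down : ∀ x y → Adj1 (x , y) (x , y - 1ℤ)
adj1-down x y rewrite ℤ.+-inverseʳ x | solve 1 (λ y → y :- (y :- con 1ℤ) := con 1ℤ) refl y = refl

adj0-diagonal : ∀ x y {dx dy} → Near x dx → Near y dy → dx ≢ x → Adj0 (x , y) (dx , dy)
adj0-diagonal x y {dx} {dy} nx ny dx≢x = (λ e → dx≢x (sym (cong proj₁ e))) , bound x dx nx , bound y dy ny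
  where
  bound : ∀ i j → Near i j → ∣ i - j ∣ ℕ.≤ 1
  bound i _ (inj₁ refl) rewrite solve 1 (λ i → i :- (i :- con 1ℤ) := con 1ℤ) refl i = ℕ.≤-refl
  bound i _ (inj₂ (inj₁ refl)) rewrite ℤ.+-inverseʳ i = z≤n
  bound i _ (inj₂ (inj₂ refl)) rewrite solve 1 (λ i → i :- (i :+ con 1ℤ) := con -1ℤ) refl i = ℕ.≤-refl

DiagonalsBridged : (Pixel → Set) → Set
DiagonalsBridged S = ∀ x y → (S (x , y) × S (x + 1ℤ , y + 1ℤ) → S (x + 1ℤ , y) ⊎ S (x , y + 1ℤ))
                           × (S (x + 1ℤ , y) × S (x , y + 1ℤ) → S (x , y) ⊎ S (x + 1ℤ , y + 1ℤ))

adj0⇒path1 : ∀ {S} → DiagonalsBridged S → ∀ {u w} → Adj0 u w → S u → S w → Path Adj1 S u w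
adj0⇒path1 {S} bridged {x , y} adj su sw with adj0⇒near adj
... | inj₂ (inj₁ refl) , inj₂ (inj₁ refl) = contradiction refl (proj₁ adj)
... | inj₂ (inj₁ refl) , inj₁ refl = step su (adj1-down x y) (single sw)
... | inj₂ (inj₁ refl) , inj₂ (inj₂ refl) = step su (adj1-up x y) (single sw)
... | inj₁ refl , inj₂ (inj₁ refl) = step su (adj1-left x y) (single sw)
... | inj₂ (inj₂ refl) , inj₂ (inj₁ refl) = step su (adj1-right x y) (single sw)
... | inj₂ (inj₂ refl) , inj₂ (inj₂ refl) with proj₁ (bridged x y) (su , sw)
...   | inj₁ s = step su (adj1-right x y) (step s (adj1-up (x + 1ℤ) y) (single sw))
...   | inj₂ s = step su (adj1-up x y) (step s (adj1-right x (y + 1ℤ)) (single sw))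
adj0⇒path1 {S} bridged {x , y} adj su sw | inj₂ (inj₂ refl) , inj₁ refl
  with proj₂ (bridged x (y - 1ℤ)) (sw , subst S (cong (x ,_) (sym (i-1+1≡i y))) su)
... | inj₁ s = step su (adj1-down x y) (step s (adj1-right x (y - 1ℤ)) (single sw))
... | inj₂ s = step su (adj1-right x y) (step (subst S (cong (x + 1ℤ ,_) (i-1+1≡i y)) s) (adj1-down (x + 1ℤ) y) (single sw))
adj0⇒path1 {S} bridged {x , y} adj su sw | inj₁ refl , inj₁ refl
  with proj₁ (bridged (x - 1ℤ) (y - 1ℤ)) (sw , subst S (cong₂ _,_ (sym (i-1+1≡i x)) (sym (i-1+1≡i y))) su)
... | inj₁ s = step su (adj1-down x y) (step (subst S (cong (_, y - 1ℤ) (i-1+1≡i x)) s) (adj1-left x (y - 1ℤ)) (single sw))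
... | inj₂ s = step su (adj1-left x y) (step (subst S (cong (x - 1ℤ ,_) (i-1+1≡i y)) s) (adj1-down (x - 1ℤ) y) (single sw))
adj0⇒path1 {S} bridged {x , y} adj su sw | inj₁ refl , inj₂ (inj₂ refl)
  with proj₂ (bridged (x - 1ℤ) y) (subst S (cong (_, y) (sym (i-1+1≡i x))) su , sw)
... | inj₁ s = step su (adj1-left x y) (step s (adj1-up (x - 1ℤ) y) (single sw))
... | inj₂ s = step su (adj1-up x y) (step (subst S (cong (_, y + 1ℤ) (i-1+1≡i x)) s) (adj1-left x (y + 1ℤ)) (single sw))

path0⇒path1 : ∀ {S} → DiagonalsBridged S → ∀ {a b} → Path Adj0 S a b → Path Adj1 S a b
path0⇒path1 bridged (single s) = single s
path0⇒path1 bridged (step s e p) = adj0⇒path1 bridged e s (path-start p) ++ᵖ path0⇒path1 bridged p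

no-tunnel⇒bridged : ∀ M → (∀ w → ¬ IsZeroTunnel M w) → DiagonalsBridged (InM M)
no-tunnel⇒bridged M no-tunnel x y = bridge₁ , bridge₂
  where
  bridge₁ : (x , y) ∈ M × (x + 1ℤ , y + 1ℤ) ∈ M → (x + 1ℤ , y) ∈ M ⊎ (x , y + 1ℤ) ∈ M
  bridge₁ (m₁ , m₄) with (x + 1ℤ , y) ∈? M | (x , y + 1ℤ) ∈? M
  ... | yes m₂ | _ = inj₁ m₂
  ... | no _ | yes m₃ = inj₂ m₃
  ... | no m₂ | no m₃ = contradiction (inj₁ (m₁ , m₄ , m₂ , m₃)) (no-tunnel (x , y))
  bridge₂ : (x + 1ℤ , y) ∈ M × (x , y + 1ℤ) ∈ M → (x , y) ∈ M ⊎ (x + 1ℤ , y + 1ℤ) ∈ M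
  bridge₂ (m₂ , m₃) with (x , y) ∈? M | (x + 1ℤ , y + 1ℤ) ∈? M
  ... | yes m₁ | _ = inj₁ m₁
  ... | no _ | yes m₄ = inj₂ m₄
  ... | no m₁ | no m₄ = contradiction (inj₂ (m₂ , m₃ , m₁ , m₄)) (no-tunnel (x , y))

no-tunnel⇒bridged-complement : ∀ M → (∀ w → ¬ IsZeroTunnel M w) → DiagonalsBridged (NotInM M)
no-tunnel⇒bridged-complement M no-tunnel x y = bridge₁ , bridge₂
  where
  bridge₁ : (x , y) ∉ M × (x + 1ℤ , y + 1ℤ) ∉ M → (x + 1ℤ , y) ∉ M ⊎ (x , y + 1ℤ) ∉ M
  bridge₁ (m₁ , m₄) with (x + 1ℤ , y) ∈? M | (x , y + 1ℤ) ∈? M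
  ... | no m₂ | _ = inj₁ m₂
  ... | yes _ | no m₃ = inj₂ m₃
  ... | yes m₂ | yes m₃ = contradiction (inj₂ (m₂ , m₃ , m₁ , m₄)) (no-tunnel (x , y))
  bridge₂ : (x + 1ℤ , y) ∉ M × (x , y + 1ℤ) ∉ M → (x , y) ∉ M ⊎ (x + 1ℤ , y + 1ℤ) ∉ M
  bridge₂ (m₂ , m₃) with (x , y) ∈? M | (x + 1ℤ , y + 1ℤ) ∈? M
  ... | no m₁ | _ = inj₁ m₁
  ... | yes _ | no m₄ = inj₂ m₄
  ... | yes m₁ | yes m₄ = contradiction (inj₁ (m₁ , m₄ , m₂ , m₃)) (no-tunnel (x , y))

module _ {A : Set} where

  ∈-remove : ∀ {x v : A} xs {ys} → x ∈ xs ++ v ∷ ys → x ≢ v → x ∈ xs ++ ys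
  ∈-remove [] (here x≡v) x≢v = contradiction x≡v x≢v
  ∈-remove [] (there x∈ys) _ = x∈ys
  ∈-remove (_ ∷ xs) (here x≡y) _ = here x≡y
  ∈-remove (_ ∷ xs) (there x∈) x≢v = there (∈-remove xs x∈ x≢v)

  unique-remove : ∀ {v : A} xs {ys} → Unique (xs ++ v ∷ ys) → Unique (xs ++ ys)
  unique-remove [] (_ ∷ u) = u
  unique-remove (_ ∷ xs) (x∉ ∷ u) = drop xs x∉ ∷ unique-remove xs u
    where
    drop : ∀ {P : A → Set} {v} xs {ys} → All P (xs ++ v ∷ ys) → All P (xs ++ ys)
    drop [] (_ ∷ ps) = ps
    drop (_ ∷ xs) (p ∷ ps) = p ∷ drop xs ps

  ∈-insert-remove : ∀ {x v : A} xs {ys} → x ∈ xs ++ ys → x ∈ xs ++ v ∷ ys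
  ∈-insert-remove xs x∈ with ∈-++⁻ xs x∈
  ... | inj₁ x∈xs = ∈-++⁺ˡ x∈xs
  ... | inj₂ x∈ys = ∈-++⁺ʳ xs (there x∈ys)

  injective-relation⇒length≤ : (R : A → A → Set) (as bs : List A) → Unique as → Unique bs →
                               (∀ {a} → a ∈ as → DoubleNegation (∃ λ b → b ∈ bs × R a b)) →
                               (∀ {a a′ b} → a ∈ as → a′ ∈ as → R a b → R a′ b → a ≡ a′) →
                               length as ℕ.≤ length bs

  injective-relation-missing⇒length< : (R : A → A → Set) (as bs : List A) → Unique as → Unique bs →
                                       (∀ {a} → a ∈ as → DoubleNegation (∃ λ b → b ∈ bs × R a b)) →
                                       (∀ {a a′ b} → a ∈ as → a′ ∈ as → R a b → R a′ b → a ≡ a′) →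
                                       ∀ {b₀} → b₀ ∈ bs → (∀ {a} → a ∈ as → ¬ R a b₀) → suc (length as) ℕ.≤ length bs

  injective-relation⇒length≤ R [] bs _ _ _ _ = z≤n
  injective-relation⇒length≤ R (a ∷ as) bs (a∉as ∷ uas) ub total injective =
    decidable-stable (suc (length as) ℕ.≤? length bs) do
      b , b∈ , Rab ← total (here refl)
      pure (injective-relation-missing⇒length< R as bs uas ub (λ a′∈ → total (there a′∈))
              (λ a₁∈ a₂∈ → injective (there a₁∈) (there a₂∈)) b∈
              (λ a′∈ Ra′b → All.lookup a∉as a′∈ (sym (injective (there a′∈) (here refl) Ra′b Rab))))

  injective-relation-missing⇒length< R as bs ua ub total injective {b₀} b₀∈ missed with ∈-∃++ b₀∈
  ... | bs₁ , bs₂ , refl = subst (suc (length as) ℕ.≤_) (sym (length-++-sucʳ bs₁ b₀ bs₂))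
    (s≤s (injective-relation⇒length≤ R as (bs₁ ++ bs₂) ua (unique-remove bs₁ ub) total′ injective))
    where
    total′ : ∀ {a} → a ∈ as → DoubleNegation (∃ λ b → b ∈ bs₁ ++ bs₂ × R a b)
    total′ a∈ = do
      b , b∈ , Rab ← total a∈
      pure (b , ∈-remove bs₁ b∈ (λ { refl → missed a∈ Rab }) , Rab)

  ⊆⇒length≤ : {xs ys : List A} → Unique xs → Unique ys → xs ⊆ ys → length xs ℕ.≤ length ys
  ⊆⇒length≤ {xs} {ys} ux uy xs⊆ys =
    injective-relation⇒length≤ _≡_ xs ys ux uy (λ {a} a∈ → pure (a , xs⊆ys a∈ , refl)) (λ _ _ e e′ → trans e (sym e′))

  ⊆⊇⇒length≡ : {xs ys : List A} → Unique xs → Unique ys → xs ⊆ ys → ys ⊆ xs → length xs ≡ length ys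
  ⊆⊇⇒length≡ ux uy xs⊆ys ys⊆xs = ℕ.≤-antisym (⊆⇒length≤ ux uy xs⊆ys) (⊆⇒length≤ uy ux ys⊆xs)

_∈ᵇ_ : Pixel → List Pixel → Bool
p ∈ᵇ X = does (p ∈? X)

∈ᵇ-true : ∀ {p X} → p ∈ X → p ∈ᵇ X ≡ true
∈ᵇ-true {p} {X} = dec-true (p ∈? X)

∈ᵇ-false : ∀ {p X} → p ∉ X → p ∈ᵇ X ≡ false
∈ᵇ-false {p} {X} = dec-false (p ∈? X)

∈ᵇ⇒∈ : ∀ {p X} → p ∈ᵇ X ≡ true → p ∈ X
∈ᵇ⇒∈ {p} {X} e with p ∈? X
... | yes p∈X = p∈X

∈ᵇ⇒∉ : ∀ {p X} → p ∈ᵇ X ≡ false → p ∉ X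
∈ᵇ⇒∉ {p} {X} e with p ∈? X
... | no p∉X = p∉X

T-∈ᵇ⁺ : ∀ {p X} → p ∈ X → T (p ∈ᵇ X)
T-∈ᵇ⁺ p∈X rewrite ∈ᵇ-true p∈X = tt

T-∈ᵇ⁻ : ∀ {p X} → T (p ∈ᵇ X) → p ∈ X
T-∈ᵇ⁻ {p} {X} t with p ∈? X
... | yes p∈X = p∈X
... | no _ = ⊥-elim t

∈ᵇ-cong : ∀ {p X Y} → (p ∈ X → p ∈ Y) → (p ∈ Y → p ∈ X) → p ∈ᵇ X ≡ p ∈ᵇ Y
∈ᵇ-cong {p} {X} {Y} to from with p ∈? X | p ∈? Y
... | yes _ | yes _ = refl
... | no _ | no _ = refl
... | yes p∈X | no p∉Y = contradiction (to p∈X) p∉Y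
... | no p∉X | yes p∈Y = contradiction (from p∈Y) p∉X

indicator : Bool → ℤ
indicator true = 1ℤ
indicator false = 0ℤ

module _ {A : Set} where

  ∑ : List A → (A → ℤ) → ℤ
  ∑ [] f = 0ℤ
  ∑ (x ∷ xs) f = f x + ∑ xs f

  ∑-cong : ∀ xs {f g : A → ℤ} → (∀ {v} → v ∈ xs → f v ≡ g v) → ∑ xs f ≡ ∑ xs g
  ∑-cong [] _ = refl
  ∑-cong (x ∷ xs) f≗g = cong₂ _+_ (f≗g (here refl)) (∑-cong xs (λ v∈ → f≗g (there v∈)))

  ∑-zero : ∀ xs {f : A → ℤ} → (∀ {v} → v ∈ xs → f v ≡ 0ℤ) → ∑ xs f ≡ 0ℤ
  ∑-zero [] _ = refl
  ∑-zero (x ∷ xs) f≗0 rewrite f≗0 (here refl) = trans (ℤ.+-identityˡ _) (∑-zero xs (λ v∈ → f≗0 (there v∈)))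

  ∑-++ : ∀ xs ys (f : A → ℤ) → ∑ (xs ++ ys) f ≡ ∑ xs f + ∑ ys f
  ∑-++ [] ys f = sym (ℤ.+-identityˡ _)
  ∑-++ (x ∷ xs) ys f rewrite ∑-++ xs ys f = sym (ℤ.+-assoc (f x) (∑ xs f) (∑ ys f))

  ∑-+ : ∀ xs (f g : A → ℤ) → ∑ xs (λ v → f v + g v) ≡ ∑ xs f + ∑ xs g
  ∑-+ [] f g = refl
  ∑-+ (x ∷ xs) f g rewrite ∑-+ xs f g =
    solve 4 (λ a b c d → (a :+ b) :+ (c :+ d) := (a :+ c) :+ (b :+ d)) refl (f x) (g x) (∑ xs f) (∑ xs g)

  ∑-minus : ∀ xs (f g : A → ℤ) → ∑ xs (λ v → f v - g v) ≡ ∑ xs f - ∑ xs g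
  ∑-minus [] f g = refl
  ∑-minus (x ∷ xs) f g rewrite ∑-minus xs f g =
    solve 4 (λ a b c d → (a :- b) :+ (c :- d) := (a :+ c) :- (b :+ d)) refl (f x) (g x) (∑ xs f) (∑ xs g)

  ∑-*ˡ : ∀ xs c (f : A → ℤ) → ∑ xs (λ v → c * f v) ≡ c * ∑ xs f
  ∑-*ˡ [] c f = sym (ℤ.*-zeroʳ c)
  ∑-*ˡ (x ∷ xs) c f rewrite ∑-*ˡ xs c f = sym (ℤ.*-distribˡ-+ c (f x) (∑ xs f))

  ∑-indicator : ∀ xs (p : A → Bool) → ∑ xs (λ v → indicator (p v)) ≡ + length (filterᵇ p xs)
  ∑-indicator [] p = refl
  ∑-indicator (x ∷ xs) p with p x
  ... | true = cong (λ s → 1ℤ + s) (∑-indicator xs p)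
  ... | false = trans (ℤ.+-identityˡ _) (∑-indicator xs p)

  ∑-remove : ∀ xs {ys} {v : A} (f : A → ℤ) → ∑ (xs ++ v ∷ ys) f ≡ f v + ∑ (xs ++ ys) f
  ∑-remove [] f = refl
  ∑-remove (x ∷ xs) {ys} {v} f = trans (cong (λ s → f x + s) (∑-remove xs f))
    (solve 3 (λ a b c → a :+ (b :+ c) := b :+ (a :+ c)) refl (f x) (f v) (∑ (xs ++ ys) f))

  unique-remove-≢ : ∀ {v u : A} xs {ys} → Unique (xs ++ v ∷ ys) → u ∈ xs ++ ys → u ≢ v
  unique-remove-≢ [] (v∉ys ∷ _) u∈ys u≡v = All.lookup v∉ys u∈ys (sym u≡v)
  unique-remove-≢ (x ∷ xs) (x∉ ∷ _) (here refl) = All.lookup x∉ (∈-insert xs)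
  unique-remove-≢ (x ∷ xs) (_ ∷ u) (there u∈) = unique-remove-≢ xs u u∈

  ∑-support : ∀ xs ws (f : A → ℤ) → Unique xs → Unique ws → ws ⊆ xs →
              (∀ {v} → v ∈ xs → v ∉ ws → f v ≡ 0ℤ) → ∑ xs f ≡ ∑ ws f
  ∑-support xs [] f _ _ _ zero-off = ∑-zero xs (λ v∈ → zero-off v∈ λ ())
  ∑-support xs (w ∷ ws) f uxs (w∉ws ∷ uws) ws⊆xs zero-off with ∈-∃++ (ws⊆xs (here refl))
  ... | xs₁ , xs₂ , refl = trans (∑-remove xs₁ f) (cong (λ s → f w + s)
    (∑-support (xs₁ ++ xs₂) ws f (unique-remove xs₁ uxs) uws ws⊆xs′ zero-off′))
    where
    ws⊆xs′ : ws ⊆ xs₁ ++ xs₂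
    ws⊆xs′ v∈ = ∈-remove xs₁ (ws⊆xs (there v∈)) (λ { refl → All.lookup w∉ws v∈ refl })
    zero-off′ : ∀ {v} → v ∈ xs₁ ++ xs₂ → v ∉ ws → f v ≡ 0ℤ
    zero-off′ v∈ v∉ws = zero-off (∈-insert-remove xs₁ v∈)
      λ { (here refl) → unique-remove-≢ xs₁ uxs v∈ refl ; (there v∈ws) → v∉ws v∈ws }

∑-map : ∀ {A B : Set} (g : A → B) xs (f : B → ℤ) → ∑ (map g xs) f ≡ ∑ xs (λ v → f (g v))
∑-map g [] f = refl
∑-map g (x ∷ xs) f = cong (λ s → f (g x) + s) (∑-map g xs f)

module _ {A B : Set} where

  ∑-cartesianProduct : ∀ xs ys (F : A → ℤ) (G : B → ℤ) →
                       ∑ (cartesianProduct xs ys) (λ p → F (proj₁ p) * G (proj₂ p)) ≡ ∑ xs F * ∑ ys G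
  ∑-cartesianProduct [] ys F G = sym (ℤ.*-zeroˡ (∑ ys G))
  ∑-cartesianProduct (x ∷ xs) ys F G = begin
    ∑ (map (x ,_) ys ++ cartesianProduct xs ys) FG
      ≡⟨ ∑-++ (map (x ,_) ys) (cartesianProduct xs ys) FG ⟩
    ∑ (map (x ,_) ys) FG + ∑ (cartesianProduct xs ys) FG
      ≡⟨ cong₂ _+_ (trans (∑-map (x ,_) ys FG) (∑-*ˡ ys (F x) G)) (∑-cartesianProduct xs ys F G) ⟩
    F x * ∑ ys G + ∑ xs F * ∑ ys G
      ≡⟨ sym (ℤ.*-distribʳ-+ (∑ ys G) (F x) (∑ xs F)) ⟩
    (F x + ∑ xs F) * ∑ ys G ∎
    where
    open ≡-Reasoning
    FG : A × B → ℤ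
    FG p = F (proj₁ p) * G (proj₂ p)

i+[1+k]≡i+k+1 : ∀ i k → i + + suc k ≡ i + + k + 1ℤ
i+[1+k]≡i+k+1 i k = trans (cong (λ t → i + + t) (ℕ.+-comm 1 k)) (sym (ℤ.+-assoc i (+ k) 1ℤ))

≤⇒offset : ∀ {i j} → i ≤ j → ∃ λ k → j ≡ i + + k
≤⇒offset {i} {j} i≤j = ∣ j - i ∣ , trans (solve 2 (λ i j → j := i :+ (j :- i)) refl i j)
                                         (cong (λ t → i + t) (sym (ℤ.0≤i⇒+∣i∣≡i (ℤ.i≤j⇒0≤j-i i≤j))))

i<i+[1+k] : ∀ i k → i < i + + suc k
i<i+[1+k] i k = subst (_< i + + suc k) (ℤ.+-identityʳ i) (ℤ.+-monoʳ-< i (+<+ (s≤s z≤n)))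

i<i+1 : ∀ i → i < i + 1ℤ
i<i+1 i = i<i+[1+k] i 0

i-1<i : ∀ i → i - 1ℤ < i
i-1<i i = subst (i - 1ℤ <_) (i-1+1≡i i) (i<i+1 (i - 1ℤ))

i≢i-1 : ∀ i → i ≢ i - 1ℤ
i≢i-1 i i≡i-1 = ℤ.<-irrefl (sym i≡i-1) (i-1<i i)

range : ℤ → ℕ → List ℤ
range a zero = []
range a (suc n) = a ∷ range (a + 1ℤ) n

box : ℤ → ℕ → List Pixel
box a n = cartesianProduct (range a n) (range a n)

i+1+k≡i+[1+k] : ∀ i k → i + 1ℤ + + k ≡ i + + suc k
i+1+k≡i+[1+k] i k = solve 2 (λ i k → i :+ con 1ℤ :+ k := i :+ (con 1ℤ :+ k)) refl i (+ k)

∈-range⁺ : ∀ a {n i} → i ℕ.< n → a + + i ∈ range a n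
∈-range⁺ a {suc n} {zero} _ = here (ℤ.+-identityʳ a)
∈-range⁺ a {suc n} {suc i} (s≤s i<n) = there (subst (_∈ range (a + 1ℤ) n) (i+1+k≡i+[1+k] a i) (∈-range⁺ (a + 1ℤ) i<n))

∈-range⁻ : ∀ a {n x} → x ∈ range a n → ∃ λ i → i ℕ.< n × x ≡ a + + i
∈-range⁻ a {suc n} (here refl) = 0 , s≤s z≤n , sym (ℤ.+-identityʳ a)
∈-range⁻ a {suc n} (there x∈) with ∈-range⁻ (a + 1ℤ) x∈
... | i , i<n , refl = suc i , s≤s i<n , i+1+k≡i+[1+k] a i

range-lower : ∀ a n {x} → x ∈ range a n → a ≤ x
range-lower a n x∈ with ∈-range⁻ a x∈
... | i , _ , refl = ℤ.i≤i+j a (+ i)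

range-upper : ∀ a n {x} → x ∈ range a n → x < a + + n
range-upper a n x∈ with ∈-range⁻ a x∈
... | i , i<n , refl = ℤ.+-monoʳ-< a (+<+ i<n)

below-range : ∀ a n {x} → x < a → x ∉ range a n
below-range a n x<a x∈ = ℤ.≤⇒≯ (range-lower a n x∈) x<a

above-range : ∀ a n {x} → a + + n ≤ x → x ∉ range a n
above-range a n a+n≤x x∈ = ℤ.<⇒≱ (range-upper a n x∈) a+n≤x

range-classify : ∀ a n x → x < a ⊎ x ∈ range a n ⊎ a + + n ≤ x
range-classify a n x with x ℤ.<? a
... | yes x<a = inj₁ x<a
... | no x≮a with ≤⇒offset (ℤ.≮⇒≥ x≮a)
...   | k , refl with k ℕ.<? n
...     | yes k<n = inj₂ (inj₁ (∈-range⁺ a k<n))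
...     | no k≮n = inj₂ (inj₂ (ℤ.+-monoʳ-≤ a (+≤+ (ℕ.≮⇒≥ k≮n))))

unique-range : ∀ a n → Unique (range a n)
unique-range a zero = []
unique-range a (suc n) =
  All.tabulate (λ x∈ a≡x → below-range (a + 1ℤ) n (i<i+1 a) (subst (_∈ range (a + 1ℤ) n) (sym a≡x) x∈))
  ∷ unique-range (a + 1ℤ) n

unique-box : ∀ a n → Unique (box a n)
unique-box a n = Unique.cartesianProduct⁺ (unique-range a n) (unique-range a n)

∈-box⁺ : ∀ a n {x y} → x ∈ range a n → y ∈ range a n → (x , y) ∈ box a n
∈-box⁺ a n = ∈-cartesianProduct⁺

∈-box⁻ : ∀ a n {x y} → (x , y) ∈ box a n → x ∈ range a n × y ∈ range a n
∈-box⁻ a n = ∈-cartesianProduct⁻ (range a n) (range a n)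

straight-path : ∀ {S} (f : ℕ → Pixel) → (∀ j → Adj1 (f j) (f (suc j))) → ∀ k →
                (∀ j → j ℕ.≤ k → S (f j)) → Path Adj1 S (f 0) (f k)
straight-path f adj zero s = single (s 0 z≤n)
straight-path f adj (suc k) s =
  path-snoc (straight-path f adj k (λ j j≤k → s j (ℕ.m≤n⇒m≤1+n j≤k))) (adj k) (s (suc k) ℕ.≤-refl)

vertical-path : ∀ {S} x y k → (∀ j → j ℕ.≤ k → S (x , y + + j)) → Path Adj1 S (x , y) (x , y + + k)
vertical-path {S} x y k s = subst (λ p → Path Adj1 S p (x , y + + k)) (cong (x ,_) (ℤ.+-identityʳ y))
  (straight-path (λ j → x , y + + j)
    (λ j → subst (λ t → Adj1 (x , y + + j) (x , t)) (sym (i+[1+k]≡i+k+1 y j)) (adj1-up x (y + + j))) k s)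

horizontal-path : ∀ {S} x y k → (∀ j → j ℕ.≤ k → S (x + + j , y)) → Path Adj1 S (x , y) (x + + k , y)
horizontal-path {S} x y k s = subst (λ p → Path Adj1 S p (x + + k , y)) (cong (_, y) (ℤ.+-identityʳ x))
  (straight-path (λ j → x + + j , y)
    (λ j → subst (λ t → Adj1 (x + + j , y) (t , y)) (sym (i+[1+k]≡i+k+1 x j)) (adj1-right (x + + j) y)) k s)

ray-leaves-list : (g : Pixel → ℤ) (c : ℤ) (L : List Pixel) →
                  ∃ λ K → ∀ k → K ℕ.≤ k → ∀ {p} → p ∈ L → g p ≢ c + + k
ray-leaves-list g c [] = 0 , λ _ _ ()
ray-leaves-list g c (q ∷ L) with ray-leaves-list g c L
... | K , misses = K ℕ.+ suc ∣ g q - c ∣ , misses′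
  where
  misses′ : ∀ k → K ℕ.+ suc ∣ g q - c ∣ ℕ.≤ k → ∀ {p} → p ∈ q ∷ L → g p ≢ c + + k
  misses′ k K′≤k (there p∈L) = misses k (ℕ.≤-trans (ℕ.m≤m+n K _) K′≤k) p∈L
  misses′ k K′≤k (here refl) gq≡c+k = ℕ.<-irrefl refl (ℕ.≤-trans (ℕ.m≤n+m _ K) (ℕ.≤-trans K′≤k
    (ℕ.≤-reflexive (cong ∣_∣ (sym (trans (cong (_- c) gq≡c+k) (solve 2 (λ c k → c :+ k :- c := k) refl c (+ k))))))))

¬finite-ray : ∀ {P : Pixel → Set} (f : ℕ → Pixel) (g : Pixel → ℤ) c →
              (∀ k → g (f k) ≡ c + + k) → (∀ k → P (f k)) → ¬ Finite P
¬finite-ray f g c on-ray in-P (L , covers) with ray-leaves-list g c L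
... | K , misses = misses K ℕ.≤-refl (covers (f K) (in-P K)) (on-ray K)

upward-ray-infinite : ∀ X x y → (∀ k → (x , y + + k) ∉ X) → ¬ Finite (Conn1c X (x , y))
upward-ray-infinite X x y free =
  ¬finite-ray (λ k → x , y + + k) proj₂ y (λ _ → refl) (λ k → vertical-path x y k (λ j _ → free j))

rightward-ray-infinite : ∀ X x y → (∀ k → (x + + k , y) ∉ X) → ¬ Finite (Conn1c X (x , y))
rightward-ray-infinite X x y free =
  ¬finite-ray (λ k → x + + k , y) proj₁ x (λ _ → refl) (λ k → horizontal-path x y k (λ j _ → free j))

finite-along : ∀ {X z w} → Conn1c X z w → Finite (Conn1c X z) → Finite (Conn1c X w)
finite-along z~w (L , covers) = L , λ v w~v → covers v (z~w ++ᵖ w~v)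

outside-box-infinite : ∀ {X} a n → X ⊆ box a n → ∀ {p} → p ∉ box a n → ¬ Finite (Conn1c X p)
outside-box-infinite {X} a n X⊆box {x , y} p∉box with range-classify a n x
... | inj₁ x<a = upward-ray-infinite X x y (λ _ m → below-range a n x<a (proj₁ (∈-box⁻ a n (X⊆box m))))
... | inj₂ (inj₂ a+n≤x) = upward-ray-infinite X x y (λ _ m → above-range a n a+n≤x (proj₁ (∈-box⁻ a n (X⊆box m))))
... | inj₂ (inj₁ x∈) with range-classify a n y
...   | inj₁ y<a = rightward-ray-infinite X x y (λ _ m → below-range a n y<a (proj₂ (∈-box⁻ a n (X⊆box m))))
...   | inj₂ (inj₂ a+n≤y) = rightward-ray-infinite X x y (λ _ m → above-range a n a+n≤y (proj₂ (∈-box⁻ a n (X⊆box m))))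
...   | inj₂ (inj₁ y∈) = contradiction (∈-box⁺ a n x∈ y∈) p∉box

finite-component-in-box : ∀ {X} a n → X ⊆ box a n → ∀ {p} → Finite (Conn1c X p) → p ∈ box a n
finite-component-in-box a n X⊆box {p} finite with p ∈? box a n
... | yes p∈ = p∈
... | no p∉ = contradiction finite (outside-box-infinite a n X⊆box p∉)

column-escape : ∀ {X} c → (∀ j → (c , j) ∉ X) → ∀ h y → ∃ λ w → Conn1c X (c , y) w × h ≤ proj₂ w
column-escape c free h y with h ℤ.≤? y
... | yes h≤y = (c , y) , single (free y) , h≤y
... | no h≰y with ≤⇒offset (ℤ.<⇒≤ (ℤ.≰⇒> h≰y))
...   | k , h≡y+k = (c , y + + k) , vertical-path c y k (λ j _ → free _) , ℤ.≤-reflexive h≡y+k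

escape-above : ∀ {X} a n → X ⊆ box a n → ∀ {z} → z ∉ box a n → ∃ λ w → Conn1c X z w × a + + n ≤ proj₂ w
escape-above {X} a n X⊆box {zx , zy} z∉ with range-classify a n zx
... | inj₁ zx<a = column-escape zx (λ _ m → below-range a n zx<a (proj₁ (∈-box⁻ a n (X⊆box m)))) (a + + n) zy
... | inj₂ (inj₂ a+n≤zx) = column-escape zx (λ _ m → above-range a n a+n≤zx (proj₁ (∈-box⁻ a n (X⊆box m)))) (a + + n) zy
... | inj₂ (inj₁ zx∈) with range-classify a n zy
...   | inj₂ (inj₂ a+n≤zy) = (zx , zy) , single (λ m → above-range a n a+n≤zy (proj₂ (∈-box⁻ a n (X⊆box m)))) , a+n≤zy
...   | inj₂ (inj₁ zy∈) = contradiction (∈-box⁺ a n zx∈ zy∈) z∉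
...   | inj₁ zy<a with ≤⇒offset (ℤ.<⇒≤ (range-upper a n zx∈))
...     | k , a+n≡zx+k
        with column-escape (a + + n) (λ _ m → above-range a n ℤ.≤-refl (proj₁ (∈-box⁻ a n (X⊆box m)))) (a + + n) zy
...       | w , up , high = w , subst (λ t → Conn1c X (zx , zy) (t , zy)) (sym a+n≡zx+k) right ++ᵖ up , high
  where
  right : Conn1c X (zx , zy) (zx + + k , zy)
  right = horizontal-path zx zy k (λ _ _ m → below-range a n zy<a (proj₂ (∈-box⁻ a n (X⊆box m))))

module _ (P : Pixel → Set) (R : Pixel → Pixel → Set) (R-refl : ∀ {z} → P z → R z z) (R-sym : ∀ {z w} → R z w → R w z) where

  private
    Covers : List Pixel → List Pixel → Set
    Covers L T = ∀ z → z ∈ L → P z → ∃ λ r → r ∈ T × R z r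

    Separated : List Pixel → Set
    Separated T = Unique T × (∀ r → r ∈ T → P r) × (∀ r s → r ∈ T → s ∈ T → r ≢ s → ¬ R r s)

    PartialTransversal : List Pixel → List Pixel → Set
    PartialTransversal L T = Separated T × Covers L T

    extend : ∀ {L} z T → PartialTransversal L T → Dec (∃ λ r → r ∈ T × R z r) → Dec (P z) →
             ∃ (PartialTransversal (z ∷ L))
    extend z T (sep , covers) _ (no ¬Pz) = T , sep , covers′
      where
      covers′ : Covers (z ∷ _) T
      covers′ _ (here refl) Pz = contradiction Pz ¬Pz
      covers′ w (there w∈) = covers w w∈
    extend z T (sep , covers) (yes found) _ = T , sep , covers′
      where
      covers′ : Covers (z ∷ _) T
      covers′ _ (here refl) _ = found
      covers′ w (there w∈) = covers w w∈
    extend z T ((uT , inP , apart) , covers) (no uncovered) (yes Pz) = z ∷ T , (uT′ , inP′ , apart′) , covers′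
      where
      uT′ : Unique (z ∷ T)
      uT′ = All.tabulate (λ {r} r∈ z≡r → uncovered (r , r∈ , subst (R z) z≡r (R-refl Pz))) ∷ uT
      inP′ : ∀ r → r ∈ z ∷ T → P r
      inP′ _ (here refl) = Pz
      inP′ r (there r∈) = inP r r∈
      apart′ : ∀ r s → r ∈ z ∷ T → s ∈ z ∷ T → r ≢ s → ¬ R r s
      apart′ _ _ (here refl) (here refl) r≢s _ = r≢s refl
      apart′ _ s (here refl) (there s∈) _ Rzs = uncovered (s , s∈ , Rzs)
      apart′ r _ (there r∈) (here refl) _ Rrz = uncovered (r , r∈ , R-sym Rrz)
      apart′ r s (there r∈) (there s∈) = apart r s r∈ s∈
      covers′ : Covers (z ∷ _) (z ∷ T)
      covers′ _ (here refl) _ = z , here refl , R-refl Pz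
      covers′ w (there w∈) Pw with covers w w∈ Pw
      ... | r , r∈ , Rwr = r , there r∈ , Rwr

    partial-transversal : ∀ L → DoubleNegation (∃ (PartialTransversal L))
    partial-transversal [] = pure ([] , ([] , (λ _ ()) , (λ _ _ ())) , (λ _ ()))
    partial-transversal (z ∷ L) = do
      T , pt ← partial-transversal L
      covered? ← ¬¬-excluded-middle
      Pz? ← ¬¬-excluded-middle
      pure (extend z T pt covered? Pz?)

  transversal-exists : ∀ L → (∀ z → P z → z ∈ L) → DoubleNegation (∃ (Transversal P R))
  transversal-exists L P⊆L = do
    T , (uT , inP , apart) , covers ← partial-transversal L
    pure (T , uT , inP , apart , λ q Pq → covers q (P⊆L q Pq) Pq)

conn0-sym : ∀ {X z w} → Conn0 X z w → Conn0 X w z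
conn0-sym = path-reverse (λ {u} {w} → adj0-sym {u} {w})

conn1-sym : ∀ {X z w} → Conn1c X z w → Conn1c X w z
conn1-sym = path-reverse (λ {u} {w} → adj1-sym {u} {w})

components-exist : ∀ X → DoubleNegation (∃ (Transversal (InM X) (Conn0 X)))
components-exist X = transversal-exists (InM X) (Conn0 X) single conn0-sym X (λ _ z∈ → z∈)

holes-exist : ∀ X a n → X ⊆ box a n → DoubleNegation (∃ (Transversal (InFiniteHole X) (Conn1c X)))
holes-exist X a n X⊆box = transversal-exists (InFiniteHole X) (Conn1c X) (λ hole → single (proj₁ hole)) conn1-sym
  (box a n) (λ _ hole → finite-component-in-box a n X⊆box (proj₂ hole))

-- The local Euler weight

diagonal : Bool → Bool → Bool → Bool → Bool
diagonal true false b₃ b₄ = not b₃ ∧ b₄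
diagonal false true b₃ b₄ = b₃ ∧ not b₄
diagonal _ _ _ _ = false

-- Arguments: the pixels south-west, south-east, north-west and north-east of a grid point.
-- Summed over all grid points this gives 4v − 8p + 4b − 4t, with t the number of 0-tunnels.
weight : Bool → Bool → Bool → Bool → ℤ
weight b₁ b₂ b₃ b₄ =
  + 4 * indicator (b₁ ∨ b₂ ∨ b₃ ∨ b₄) - + 2 * (indicator b₁ + indicator b₂ + indicator b₃ + indicator b₄)
  + + 4 * indicator (b₁ ∧ b₂ ∧ b₃ ∧ b₄) - + 4 * indicator (diagonal b₁ b₂ b₃ b₄)

sw se nw ne : GridPoint → Pixel
sw (i , j) = i , j
se (i , j) = i + 1ℤ , j
nw (i , j) = i , j + 1ℤ
ne (i , j) = i + 1ℤ , j + 1ℤ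

weightAt : (Pixel → Bool) → GridPoint → ℤ
weightAt m v = weight (m (sw v)) (m (se v)) (m (nw v)) (m (ne v))

weightAt-≡ : ∀ m v {b₁ b₂ b₃ b₄} → m (sw v) ≡ b₁ → m (se v) ≡ b₂ → m (nw v) ≡ b₃ → m (ne v) ≡ b₄ →
             weightAt m v ≡ weight b₁ b₂ b₃ b₄
weightAt-≡ m v refl refl refl refl = refl

vertexBox : ℤ → ℕ → List GridPoint
vertexBox a n = box (a - 1ℤ) (suc n)

Ê : ℤ → ℕ → List Pixel → ℤ
Ê a n X = ∑ (vertexBox a n) (weightAt (_∈ᵇ X))

range-widen : ∀ a n {x} → x ∈ range a n → x ∈ range (a - 1ℤ) (suc n)
range-widen a n x∈ with ∈-range⁻ a x∈
... | i , i<n , refl =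
  subst (_∈ range (a - 1ℤ) (suc n)) (solve 2 (λ a i → a :- con 1ℤ :+ (con 1ℤ :+ i) := a :+ i) refl a (+ i))
                              (∈-range⁺ (a - 1ℤ) (s≤s i<n))

range-widen-pred : ∀ a n {x} → x ∈ range a n → x - 1ℤ ∈ range (a - 1ℤ) (suc n)
range-widen-pred a n x∈ with ∈-range⁻ a x∈
... | i , i<n , refl =
  subst (_∈ range (a - 1ℤ) (suc n)) (solve 2 (λ a i → a :- con 1ℤ :+ i := a :+ i :- con 1ℤ) refl a (+ i))
                              (∈-range⁺ (a - 1ℤ) (ℕ.m≤n⇒m≤1+n i<n))

vertex-in-vertexBox : ∀ a n {v q} → q ∈ box a n → IsVertexOf v q → v ∈ vertexBox a n
vertex-in-vertexBox a n {i , j} {x , y} q∈ (i≡ , j≡) with ∈-box⁻ a n q∈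
... | x∈ , y∈ = ∈-box⁺ (a - 1ℤ) (suc n) (widen x∈ i≡) (widen y∈ j≡)
  where
  widen : ∀ {t s} → t ∈ range a n → (s ≡ t) ⊎ (s ≡ t - 1ℤ) → s ∈ range (a - 1ℤ) (suc n)
  widen t∈ (inj₁ refl) = range-widen a n t∈
  widen t∈ (inj₂ refl) = range-widen-pred a n t∈

anyCorner allCorners : (Pixel → Bool) → GridPoint → Bool
anyCorner m v = m (sw v) ∨ m (se v) ∨ m (nw v) ∨ m (ne v)
allCorners m v = m (sw v) ∧ m (se v) ∧ m (nw v) ∧ m (ne v)

∑-weightAt : ∀ G m → ∑ G (weightAt m) ≡
  + 4 * ∑ G (λ v → indicator (anyCorner m v))
  - + 2 * (∑ G (λ v → indicator (m (sw v))) + ∑ G (λ v → indicator (m (se v)))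
          + ∑ G (λ v → indicator (m (nw v))) + ∑ G (λ v → indicator (m (ne v))))
  + + 4 * ∑ G (λ v → indicator (allCorners m v))
  - + 4 * ∑ G (λ v → indicator (diagonal (m (sw v)) (m (se v)) (m (nw v)) (m (ne v))))
∑-weightAt [] m = refl
∑-weightAt (v ∷ G) m rewrite ∑-weightAt G m =
  solve 14 (λ a b₁ b₂ b₃ b₄ c d sa s₁ s₂ s₃ s₄ sc sd →
    (con (+ 4) :* a :- con (+ 2) :* (b₁ :+ b₂ :+ b₃ :+ b₄) :+ con (+ 4) :* c :- con (+ 4) :* d)
    :+ (con (+ 4) :* sa :- con (+ 2) :* (s₁ :+ s₂ :+ s₃ :+ s₄) :+ con (+ 4) :* sc :- con (+ 4) :* sd)
    := con (+ 4) :* (a :+ sa) :- con (+ 2) :* ((b₁ :+ s₁) :+ (b₂ :+ s₂) :+ (b₃ :+ s₃) :+ (b₄ :+ s₄))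
       :+ con (+ 4) :* (c :+ sc) :- con (+ 4) :* (d :+ sd)) refl
    (indicator (anyCorner m v)) (indicator (m (sw v))) (indicator (m (se v))) (indicator (m (nw v)))
    (indicator (m (ne v))) (indicator (allCorners m v))
    (indicator (diagonal (m (sw v)) (m (se v)) (m (nw v)) (m (ne v))))
    (∑ G (λ v → indicator (anyCorner m v))) (∑ G (λ v → indicator (m (sw v)))) (∑ G (λ v → indicator (m (se v))))
    (∑ G (λ v → indicator (m (nw v)))) (∑ G (λ v → indicator (m (ne v)))) (∑ G (λ v → indicator (allCorners m v)))
    (∑ G (λ v → indicator (diagonal (m (sw v)) (m (se v)) (m (nw v)) (m (ne v)))))

module _ {A : Set} where

  ∑-indicator-enumerates : ∀ G L (p : A → Bool) {P : A → Set} → Unique G → Enumerates L P →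
                           (∀ {v} → T (p v) → P v) → (∀ {v} → P v → v ∈ G × T (p v)) →
                           ∑ G (λ v → indicator (p v)) ≡ + length L
  ∑-indicator-enumerates G L p uG (uL , L≡P) sound complete =
    trans (∑-indicator G p) (cong +_ (⊆⊇⇒length≡ (Unique.filter⁺ (λ v → T? (p v)) {G} uG) uL filtered⊆L L⊆filtered))
    where
    filtered⊆L : filterᵇ p G ⊆ L
    filtered⊆L v∈ = proj₂ (L≡P _) (sound (proj₂ (∈-filter⁻ (λ v → T? (p v)) {xs = G} v∈)))
    L⊆filtered : L ⊆ filterᵇ p G
    L⊆filtered v∈ with complete (proj₁ (L≡P _) v∈)
    ... | v∈G , pv = ∈-filter⁺ (λ v → T? (p v)) v∈G pv

  ∑-indicator-bijection : ∀ G (M : List Pixel) (c : A → Pixel) → Unique G → Unique M →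
                          (∀ {v w} → c v ≡ c w → v ≡ w) → (∀ {m} → m ∈ M → ∃ λ v → v ∈ G × c v ≡ m) →
                          ∑ G (λ v → indicator (c v ∈ᵇ M)) ≡ + length M
  ∑-indicator-bijection G M c uG uM c-injective onto =
    trans (∑-indicator G (λ v → c v ∈ᵇ M)) (cong +_ (trans (sym (length-map c selected))
      (⊆⊇⇒length≡ (Unique.map⁺ c-injective (Unique.filter⁺ (λ v → T? (c v ∈ᵇ M)) {G} uG)) uM image⊆M M⊆image)))
    where
    selected : List A
    selected = filterᵇ (λ v → c v ∈ᵇ M) G
    image⊆M : map c selected ⊆ M
    image⊆M m∈ with ∈-map⁻ c m∈
    ... | v , v∈ , refl = T-∈ᵇ⁻ (proj₂ (∈-filter⁻ (λ v → T? (c v ∈ᵇ M)) {xs = G} v∈))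
    M⊆image : M ⊆ map c selected
    M⊆image m∈ with onto m∈
    ... | v , v∈G , refl = ∈-map⁺ c (∈-filter⁺ (λ v → T? (c v ∈ᵇ M)) v∈G (T-∈ᵇ⁺ m∈))

corner-is-vertex : ∀ v → IsVertexOf v (sw v) × IsVertexOf v (se v) × IsVertexOf v (nw v) × IsVertexOf v (ne v)
corner-is-vertex (i , j) = (inj₁ refl , inj₁ refl) , (inj₂ (sym (i+1-1≡i i)) , inj₁ refl)
                         , (inj₁ refl , inj₂ (sym (i+1-1≡i j))) , (inj₂ (sym (i+1-1≡i i)) , inj₂ (sym (i+1-1≡i j)))

vertex-is-corner : ∀ {v q} → IsVertexOf v q → q ≡ sw v ⊎ q ≡ se v ⊎ q ≡ nw v ⊎ q ≡ ne v
vertex-is-corner {i , j} {x , y} (inj₁ refl , inj₁ refl) = inj₁ refl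
vertex-is-corner {i , j} {x , y} (inj₂ refl , inj₁ refl) = inj₂ (inj₁ (cong (_, j) (sym (i-1+1≡i x))))
vertex-is-corner {i , j} {x , y} (inj₁ refl , inj₂ refl) = inj₂ (inj₂ (inj₁ (cong (i ,_) (sym (i-1+1≡i y)))))
vertex-is-corner {i , j} {x , y} (inj₂ refl , inj₂ refl) = inj₂ (inj₂ (inj₂ (cong₂ _,_ (sym (i-1+1≡i x)) (sym (i-1+1≡i y)))))

T-∨⁴ : ∀ a b c d → T (a ∨ b ∨ c ∨ d) → T a ⊎ T b ⊎ T c ⊎ T d
T-∨⁴ true _ _ _ t = inj₁ t
T-∨⁴ false true _ _ t = inj₂ (inj₁ t)
T-∨⁴ false false true _ t = inj₂ (inj₂ (inj₁ t))
T-∨⁴ false false false d t = inj₂ (inj₂ (inj₂ t))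

module _ (M : List Pixel) where

  T-any⁺ : ∀ {v q} → q ∈ M → q ≡ sw v ⊎ q ≡ se v ⊎ q ≡ nw v ⊎ q ≡ ne v → T (anyCorner (_∈ᵇ M) v)
  T-any⁺ {v} q∈ corner with sw v ∈ᵇ M in e₁ | se v ∈ᵇ M in e₂ | nw v ∈ᵇ M in e₃ | ne v ∈ᵇ M in e₄
  ... | true | _ | _ | _ = tt
  ... | false | true | _ | _ = tt
  ... | false | false | true | _ = tt
  ... | false | false | false | true = tt
  ... | false | false | false | false with corner
  ...   | inj₁ refl = ∈ᵇ⇒∉ e₁ q∈
  ...   | inj₂ (inj₁ refl) = ∈ᵇ⇒∉ e₂ q∈
  ...   | inj₂ (inj₂ (inj₁ refl)) = ∈ᵇ⇒∉ e₃ q∈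
  ...   | inj₂ (inj₂ (inj₂ refl)) = ∈ᵇ⇒∉ e₄ q∈

  T-any⁻ : ∀ {v} → T (anyCorner (_∈ᵇ M) v) → IsVertexOfM M v
  T-any⁻ {v} t with T-∨⁴ (sw v ∈ᵇ M) (se v ∈ᵇ M) (nw v ∈ᵇ M) (ne v ∈ᵇ M) t
  ... | inj₁ t₁ = sw v , T-∈ᵇ⁻ t₁ , proj₁ (corner-is-vertex v)
  ... | inj₂ (inj₁ t₂) = se v , T-∈ᵇ⁻ t₂ , proj₁ (proj₂ (corner-is-vertex v))
  ... | inj₂ (inj₂ (inj₁ t₃)) = nw v , T-∈ᵇ⁻ t₃ , proj₁ (proj₂ (proj₂ (corner-is-vertex v)))
  ... | inj₂ (inj₂ (inj₂ t₄)) = ne v , T-∈ᵇ⁻ t₄ , proj₂ (proj₂ (proj₂ (corner-is-vertex v)))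

  T-all⁻ : ∀ {v} → T (allCorners (_∈ᵇ M) v) → Is2Block M v
  T-all⁻ {v} t with sw v ∈? M | se v ∈? M | nw v ∈? M | ne v ∈? M
  ... | yes m₁ | yes m₂ | yes m₃ | yes m₄ = m₁ , m₂ , m₃ , m₄

  T-all⁺ : ∀ {v} → Is2Block M v → T (allCorners (_∈ᵇ M) v)
  T-all⁺ (m₁ , m₂ , m₃ , m₄) rewrite ∈ᵇ-true m₁ | ∈ᵇ-true m₂ | ∈ᵇ-true m₃ | ∈ᵇ-true m₄ = tt

  tunnel-free⇒no-diagonal : (∀ w → ¬ IsZeroTunnel M w) →
                            ∀ v → diagonal (sw v ∈ᵇ M) (se v ∈ᵇ M) (nw v ∈ᵇ M) (ne v ∈ᵇ M) ≡ false
  tunnel-free⇒no-diagonal no-tunnel v with sw v ∈? M | se v ∈? M | nw v ∈? M | ne v ∈? M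
  ... | yes m₁ | no m₂ | no m₃ | yes m₄ = contradiction (inj₁ (m₁ , m₄ , m₂ , m₃)) (no-tunnel v)
  ... | no m₁ | yes m₂ | yes m₃ | no m₄ = contradiction (inj₂ (m₂ , m₃ , m₁ , m₄)) (no-tunnel v)
  ... | yes _ | yes _ | _ | _ = refl
  ... | no _ | no _ | _ | _ = refl
  ... | yes _ | no _ | yes _ | _ = refl
  ... | yes _ | no _ | no _ | no _ = refl
  ... | no _ | yes _ | no _ | _ = refl
  ... | no _ | yes _ | yes _ | yes _ = refl

  module _ (a : ℤ) (n : ℕ) (M⊆box : M ⊆ box a n) (uM : Unique M) where

    private
      G : List GridPoint
      G = vertexBox a n

      uG : Unique G
      uG = unique-box (a - 1ℤ) (suc n)

      corner-count : ∀ (c : GridPoint → Pixel) (c⁻¹ : Pixel → GridPoint) →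
                     (∀ v → c⁻¹ (c v) ≡ v) → (∀ q → c (c⁻¹ q) ≡ q) → (∀ q → IsVertexOf (c⁻¹ q) q) →
                     ∑ G (λ v → indicator (c v ∈ᵇ M)) ≡ + length M
      corner-count c c⁻¹ retraction section vertex = ∑-indicator-bijection G M c uG uM injective onto
        where
        injective : ∀ {v w} → c v ≡ c w → v ≡ w
        injective {v} {w} cv≡cw = trans (sym (retraction v)) (trans (cong c⁻¹ cv≡cw) (retraction w))
        onto : ∀ {q} → q ∈ M → ∃ λ v → v ∈ G × c v ≡ q
        onto {q} q∈ = c⁻¹ q , vertex-in-vertexBox a n (M⊆box q∈) (vertex q) , section q

    ∑-anyCorner : ∀ V → Enumerates V (IsVertexOfM M) → ∑ G (λ v → indicator (anyCorner (_∈ᵇ M) v)) ≡ + length V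
    ∑-anyCorner V enum = ∑-indicator-enumerates G V _ uG enum T-any⁻ complete
      where
      complete : ∀ {v} → IsVertexOfM M v → v ∈ G × T (anyCorner (_∈ᵇ M) v)
      complete (q , q∈ , vq) = vertex-in-vertexBox a n (M⊆box q∈) vq , T-any⁺ q∈ (vertex-is-corner vq)

    ∑-allCorners : ∀ B → Enumerates B (Is2Block M) → ∑ G (λ v → indicator (allCorners (_∈ᵇ M) v)) ≡ + length B
    ∑-allCorners B enum = ∑-indicator-enumerates G B _ uG enum T-all⁻ complete
      where
      complete : ∀ {v} → Is2Block M v → v ∈ G × T (allCorners (_∈ᵇ M) v)
      complete {v} block = vertex-in-vertexBox a n (M⊆box (proj₁ block)) (proj₁ (corner-is-vertex v)) , T-all⁺ block

    ∑-corners : ∑ G (λ v → indicator (sw v ∈ᵇ M)) + ∑ G (λ v → indicator (se v ∈ᵇ M))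
                + ∑ G (λ v → indicator (nw v ∈ᵇ M)) + ∑ G (λ v → indicator (ne v ∈ᵇ M)) ≡ + 4 * + length M
    ∑-corners = trans (cong₂ _+_ (cong₂ _+_ (cong₂ _+_
        (corner-count sw (λ q → q) (λ _ → refl) (λ _ → refl) (λ _ → inj₁ refl , inj₁ refl))
        (corner-count se (λ (x , y) → x - 1ℤ , y) (λ (i , j) → cong (_, j) (i+1-1≡i i))
                      (λ (x , y) → cong (_, y) (i-1+1≡i x)) (λ _ → inj₂ refl , inj₁ refl)))
        (corner-count nw (λ (x , y) → x , y - 1ℤ) (λ (i , j) → cong (i ,_) (i+1-1≡i j))
                      (λ (x , y) → cong (x ,_) (i-1+1≡i y)) (λ _ → inj₁ refl , inj₂ refl)))
        (corner-count ne (λ (x , y) → x - 1ℤ , y - 1ℤ) (λ (i , j) → cong₂ _,_ (i+1-1≡i i) (i+1-1≡i j))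
                      (λ (x , y) → cong₂ _,_ (i-1+1≡i x) (i-1+1≡i y)) (λ _ → inj₂ refl , inj₂ refl)))
      (solve 1 (λ m → m :+ m :+ m :+ m := con (+ 4) :* m) refl (+ length M))

    ∑-diagonal : (∀ w → ¬ IsZeroTunnel M w) →
                 ∑ G (λ v → indicator (diagonal (sw v ∈ᵇ M) (se v ∈ᵇ M) (nw v ∈ᵇ M) (ne v ∈ᵇ M))) ≡ 0ℤ
    ∑-diagonal no-tunnel = ∑-zero G (λ {v} _ → cong indicator (tunnel-free⇒no-diagonal no-tunnel v))

    Ê-tunnel-free : (∀ w → ¬ IsZeroTunnel M w) → ∀ V → Enumerates V (IsVertexOfM M) → ∀ B → Enumerates B (Is2Block M) →
                    Ê a n M ≡ + 4 * (+ length V - + 2 * + length M + + length B)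
    Ê-tunnel-free no-tunnel V enumV B enumB = trans (∑-weightAt G (_∈ᵇ M))
      (collect (+ length V) (+ length M) (+ length B)
               (∑-anyCorner V enumV) ∑-corners (∑-allCorners B enumB) (∑-diagonal no-tunnel))
      where
      collect : ∀ v p b {s-any s-corners s-all s-diagonal : ℤ} →
                s-any ≡ v → s-corners ≡ + 4 * p → s-all ≡ b → s-diagonal ≡ 0ℤ →
                + 4 * s-any - + 2 * s-corners + + 4 * s-all - + 4 * s-diagonal ≡ + 4 * (v - + 2 * p + b)
      collect v p b refl refl refl refl =
        solve 3 (λ v p b → con (+ 4) :* v :- con (+ 2) :* (con (+ 4) :* p) :+ con (+ 4) :* b :- con (+ 4) :* con 0ℤ
                           := con (+ 4) :* (v :- con (+ 2) :* p :+ b)) refl v p b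

-- Removing the lexicographically largest pixel

_≤ₗₑₓ_ : Pixel → Pixel → Set
(px , py) ≤ₗₑₓ (qx , qy) = py < qy ⊎ (py ≡ qy × px ≤ qx)

≤ₗₑₓ-refl : ∀ p → p ≤ₗₑₓ p
≤ₗₑₓ-refl _ = inj₂ (refl , ℤ.≤-refl)

≤ₗₑₓ-trans : ∀ {p q r} → p ≤ₗₑₓ q → q ≤ₗₑₓ r → p ≤ₗₑₓ r
≤ₗₑₓ-trans (inj₁ py<qy) (inj₁ qy<ry) = inj₁ (ℤ.<-trans py<qy qy<ry)
≤ₗₑₓ-trans (inj₁ py<qy) (inj₂ (refl , _)) = inj₁ py<qy
≤ₗₑₓ-trans (inj₂ (refl , _)) (inj₁ qy<ry) = inj₁ qy<ry
≤ₗₑₓ-trans (inj₂ (refl , px≤qx)) (inj₂ (refl , qx≤rx)) = inj₂ (refl , ℤ.≤-trans px≤qx qx≤rx)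

≤ₗₑₓ-total : ∀ p q → p ≤ₗₑₓ q ⊎ q ≤ₗₑₓ p
≤ₗₑₓ-total (px , py) (qx , qy) with ℤ.<-cmp py qy
... | tri< py<qy _ _ = inj₁ (inj₁ py<qy)
... | tri> _ _ qy<py = inj₂ (inj₁ qy<py)
... | tri≈ _ refl _ with ℤ.≤-total px qx
...   | inj₁ px≤qx = inj₁ (inj₂ (refl , px≤qx))
...   | inj₂ qx≤px = inj₂ (inj₂ (refl , qx≤px))

IsLexMax : List Pixel → Pixel → Set
IsLexMax X q = q ∈ X × (∀ {p} → p ∈ X → p ≤ₗₑₓ q)

lex-max-exists : ∀ x xs → ∃ (IsLexMax (x ∷ xs))
lex-max-exists x [] = x , here refl , λ { (here refl) → ≤ₗₑₓ-refl x }
lex-max-exists x (x′ ∷ xs) with lex-max-exists x′ xs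
... | q , q∈ , below with ≤ₗₑₓ-total x q
...   | inj₁ x≤q = q , there q∈ , λ { (here refl) → x≤q ; (there p∈) → below p∈ }
...   | inj₂ q≤x = x , here refl , λ { (here refl) → ≤ₗₑₓ-refl x ; (there p∈) → ≤ₗₑₓ-trans (below p∈) q≤x }

above-lex-max-free : ∀ {X x y} → IsLexMax X (x , y) → ∀ {p} → y < proj₂ p → p ∉ X
above-lex-max-free (_ , below) y<py p∈ with below p∈
... | inj₁ py<y = ℤ.<-asym y<py py<y
... | inj₂ (refl , _) = ℤ.<-irrefl refl y<py

right-of-lex-max-free : ∀ {X x y} → IsLexMax X (x , y) → (x + 1ℤ , y) ∉ X
right-of-lex-max-free {x = x} (_ , below) p∈ with below p∈
... | inj₁ y<y = ℤ.<-irrefl refl y<y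
... | inj₂ (_ , x+1≤x) = ℤ.<⇒≱ (i<i+1 x) x+1≤x

infixl 25 _∖_

_∖_ : List Pixel → Pixel → List Pixel
X ∖ q = filter (λ p → ¬? (p ≟ᵖ q)) X

∈-∖⁻ : ∀ X {p q} → p ∈ X ∖ q → p ∈ X × p ≢ q
∈-∖⁻ X {q = q} = ∈-filter⁻ (λ p → ¬? (p ≟ᵖ q)) {xs = X}

∈-∖⁺ : ∀ {X p q} → p ∈ X → p ≢ q → p ∈ X ∖ q
∈-∖⁺ {q = q} = ∈-filter⁺ (λ p → ¬? (p ≟ᵖ q))

∖-⊆ : ∀ X {q} → X ∖ q ⊆ X
∖-⊆ X p∈ = proj₁ (∈-∖⁻ X p∈)

∉-∖ : ∀ X {q} → q ∉ X ∖ q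
∉-∖ X q∈ = proj₂ (∈-∖⁻ X q∈) refl

unique-∖ : ∀ {X} q → Unique X → Unique (X ∖ q)
unique-∖ {X} q = Unique.filter⁺ (λ p → ¬? (p ≟ᵖ q)) {X}

length-∖ : ∀ {X q} → Unique X → q ∈ X → suc (length (X ∖ q)) ℕ.≤ length X
length-∖ {X} {q} uX q∈ = ⊆⇒length≤ (All.tabulate (λ p∈ q≡p → ∉-∖ X (subst (_∈ X ∖ q) (sym q≡p) p∈)) ∷ unique-∖ q uX) uX
  λ { (here refl) → q∈ ; (there p∈) → ∖-⊆ X p∈ }

∈ᵇ-∖-≢ : ∀ X {p q} → p ≢ q → p ∈ᵇ X ∖ q ≡ p ∈ᵇ X
∈ᵇ-∖-≢ X p≢q = ∈ᵇ-cong (∖-⊆ X) (λ p∈ → ∈-∖⁺ p∈ p≢q)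

∈ᵇ-∖-≡ : ∀ X {q} → q ∈ᵇ X ∖ q ≡ false
∈ᵇ-∖-≡ X = ∈ᵇ-false (∉-∖ X)

verticesOf : Pixel → List GridPoint
verticesOf (x , y) = (x , y) ∷ (x - 1ℤ , y) ∷ (x , y - 1ℤ) ∷ (x - 1ℤ , y - 1ℤ) ∷ []

vertex⇒∈verticesOf : ∀ {v q} → IsVertexOf v q → v ∈ verticesOf q
vertex⇒∈verticesOf (inj₁ refl , inj₁ refl) = here refl
vertex⇒∈verticesOf (inj₂ refl , inj₁ refl) = there (here refl)
vertex⇒∈verticesOf (inj₁ refl , inj₂ refl) = there (there (here refl))
vertex⇒∈verticesOf (inj₂ refl , inj₂ refl) = there (there (there (here refl)))

∈verticesOf⇒vertex : ∀ {v q} → v ∈ verticesOf q → IsVertexOf v q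
∈verticesOf⇒vertex (here refl) = inj₁ refl , inj₁ refl
∈verticesOf⇒vertex (there (here refl)) = inj₂ refl , inj₁ refl
∈verticesOf⇒vertex (there (there (here refl))) = inj₁ refl , inj₂ refl
∈verticesOf⇒vertex (there (there (there (here refl)))) = inj₂ refl , inj₂ refl

unique-verticesOf : ∀ q → Unique (verticesOf q)
unique-verticesOf (x , y) =
  (x≢ ∷ y≢ ∷ x≢ ∷ []) ∷ ((λ e → i≢i-1 x (sym (cong proj₁ e))) ∷ y≢ ∷ []) ∷ (x≢ ∷ []) ∷ [] ∷ []
  where
  x≢ : ∀ {j j′} → (x , j) ≢ (x - 1ℤ , j′)
  x≢ e = i≢i-1 x (cong proj₁ e)
  y≢ : ∀ {i i′} → (i , y) ≢ (i′ , y - 1ℤ)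
  y≢ e = i≢i-1 y (cong proj₂ e)

Ê-∖ : ∀ {X q} a n → X ⊆ box a n → q ∈ X →
      Ê a n X ≡ Ê a n (X ∖ q) + ∑ (verticesOf q) (λ v → weightAt (_∈ᵇ X) v - weightAt (_∈ᵇ X ∖ q) v)
Ê-∖ {X} {q} a n X⊆box q∈ = begin
  Ê a n X                              ≡⟨ solve 2 (λ e e′ → e := e′ :+ (e :- e′)) refl (Ê a n X) (Ê a n (X ∖ q)) ⟩
  Ê a n (X ∖ q) + (Ê a n X - Ê a n (X ∖ q))
    ≡⟨ cong (λ s → Ê a n (X ∖ q) + s) (sym (∑-minus (vertexBox a n) (weightAt (_∈ᵇ X)) (weightAt (_∈ᵇ X ∖ q)))) ⟩
  Ê a n (X ∖ q) + ∑ (vertexBox a n) difference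
    ≡⟨ cong (λ s → Ê a n (X ∖ q) + s) (∑-support (vertexBox a n) (verticesOf q) difference
         (unique-box (a - 1ℤ) (suc n)) (unique-verticesOf q)
         (λ v∈ → vertex-in-vertexBox a n (X⊆box q∈) (∈verticesOf⇒vertex v∈)) unchanged) ⟩
  Ê a n (X ∖ q) + ∑ (verticesOf q) difference ∎
  where
  open ≡-Reasoning
  difference : GridPoint → ℤ
  difference v = weightAt (_∈ᵇ X) v - weightAt (_∈ᵇ X ∖ q) v
  corner≢q : ∀ {v} → v ∉ verticesOf q → ∀ {p} → IsVertexOf v p → p ≢ q
  corner≢q v∉ vertex refl = v∉ (vertex⇒∈verticesOf vertex)
  unchanged : ∀ {v} → v ∈ vertexBox a n → v ∉ verticesOf q → difference v ≡ 0ℤ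
  unchanged {v} _ v∉ with corner-is-vertex v
  ... | c₁ , c₂ , c₃ , c₄ = trans (cong (λ w → weightAt (_∈ᵇ X) v - w)
          (weightAt-≡ (_∈ᵇ X ∖ q) v (∈ᵇ-∖-≢ X (corner≢q v∉ c₁)) (∈ᵇ-∖-≢ X (corner≢q v∉ c₂))
                       (∈ᵇ-∖-≢ X (corner≢q v∉ c₃)) (∈ᵇ-∖-≢ X (corner≢q v∉ c₄))))
        (ℤ.+-inverseʳ (weightAt (_∈ᵇ X) v))

-- Arguments: membership of the west, south-west, south and south-east neighbours of the removed pixel.
-- Its value is 8 if all four are absent, −8 if the south one is absent but the south-east one and
-- one of the west and south-west ones are present, and 0 otherwise.
removalChange : Bool → Bool → Bool → Bool → ℤ
removalChange bW bSW bS bSE =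
  (weight true false false false - weight false false false false)
  + ((weight bW true false false - weight bW false false false)
  + ((weight bS bSE true false - weight bS bSE false false)
  + (weight bSW bS bW true - weight bSW bS bW false)))

module _ {X : List Pixel} {x y : ℤ} (max : IsLexMax X (x , y)) where

  private
    q : Pixel
    q = x , y

    m m′ : Pixel → Bool
    m p = p ∈ᵇ X
    m′ p = p ∈ᵇ X ∖ q

    difference : GridPoint → ℤ
    difference v = weightAt m v - weightAt m′ v

    removed : ∀ {p} → p ≡ q → m p ≡ true × m′ p ≡ false
    removed refl = ∈ᵇ-true (proj₁ max) , ∈ᵇ-∖-≡ X

    kept : ∀ {p} → p ≢ q → m′ p ≡ m p
    kept = ∈ᵇ-∖-≢ X

    absent : ∀ {p} → p ∉ X → m p ≡ false × m′ p ≡ false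
    absent p∉ = ∈ᵇ-false p∉ , ∈ᵇ-false (λ p∈ → p∉ (∖-⊆ X p∈))

    above : ∀ x′ → (x′ , y + 1ℤ) ∉ X
    above _ = above-lex-max-free max (i<i+1 y)

    right : ∀ {y′} → y′ ≡ y → (x + 1ℤ , y′) ∉ X
    right refl = right-of-lex-max-free max

    W≢q : (x - 1ℤ , y) ≢ q
    W≢q e = i≢i-1 x (sym (cong proj₁ e))

    S≢q : ∀ {x′} → (x′ , y - 1ℤ) ≢ q
    S≢q e = i≢i-1 y (sym (cong proj₂ e))

    x-1+1 : x - 1ℤ + 1ℤ ≡ x
    x-1+1 = i-1+1≡i x

    y-1+1 : y - 1ℤ + 1ℤ ≡ y
    y-1+1 = i-1+1≡i y

    at-q : difference q ≡ weight true false false false - weight false false false false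
    at-q = cong₂ _-_ (weightAt-≡ m q (proj₁ (removed refl)) (proj₁ (absent (right refl))) (proj₁ (absent (above x)))
                                  (proj₁ (absent (above (x + 1ℤ)))))
                     (weightAt-≡ m′ q (proj₂ (removed refl)) (proj₂ (absent (right refl))) (proj₂ (absent (above x)))
                                  (proj₂ (absent (above (x + 1ℤ)))))

    at-west : difference (x - 1ℤ , y) ≡ weight (m (x - 1ℤ , y)) true false false - weight (m (x - 1ℤ , y)) false false false
    at-west = cong₂ _-_
      (weightAt-≡ m (x - 1ℤ , y) refl (proj₁ (removed qW)) (proj₁ (absent (above _))) (proj₁ (absent (above _))))
      (weightAt-≡ m′ (x - 1ℤ , y) (kept W≢q) (proj₂ (removed qW)) (proj₂ (absent (above _))) (proj₂ (absent (above _))))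
      where
      qW : (x - 1ℤ + 1ℤ , y) ≡ q
      qW = cong (_, y) x-1+1

    at-south : difference (x , y - 1ℤ) ≡ weight (m (x , y - 1ℤ)) (m (x + 1ℤ , y - 1ℤ)) true false
                                         - weight (m (x , y - 1ℤ)) (m (x + 1ℤ , y - 1ℤ)) false false
    at-south = cong₂ _-_
      (weightAt-≡ m (x , y - 1ℤ) refl refl (proj₁ (removed qS)) (proj₁ (absent (right y-1+1))))
      (weightAt-≡ m′ (x , y - 1ℤ) (kept S≢q) (kept S≢q) (proj₂ (removed qS)) (proj₂ (absent (right y-1+1))))
      where
      qS : (x , y - 1ℤ + 1ℤ) ≡ q
      qS = cong (x ,_) y-1+1

    at-south-west : difference (x - 1ℤ , y - 1ℤ) ≡ weight (m (x - 1ℤ , y - 1ℤ)) (m (x , y - 1ℤ)) (m (x - 1ℤ , y)) true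
                                                 - weight (m (x - 1ℤ , y - 1ℤ)) (m (x , y - 1ℤ)) (m (x - 1ℤ , y)) false
    at-south-west = cong₂ _-_
      (weightAt-≡ m (x - 1ℤ , y - 1ℤ) refl (cong m S′) (cong m W′) (proj₁ (removed qSW)))
      (weightAt-≡ m′ (x - 1ℤ , y - 1ℤ) (kept S≢q) (trans (cong m′ S′) (kept S≢q)) (trans (cong m′ W′) (kept W≢q))
                  (proj₂ (removed qSW)))
      where
      S′ : (x - 1ℤ + 1ℤ , y - 1ℤ) ≡ (x , y - 1ℤ)
      S′ = cong (_, y - 1ℤ) x-1+1
      W′ : (x - 1ℤ , y - 1ℤ + 1ℤ) ≡ (x - 1ℤ , y)
      W′ = cong (x - 1ℤ ,_) y-1+1
      qSW : (x - 1ℤ + 1ℤ , y - 1ℤ + 1ℤ) ≡ q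
      qSW = cong₂ _,_ x-1+1 y-1+1

  Ê-remove-lex-max : ∀ a n → X ⊆ box a n →
                     Ê a n X ≡ Ê a n (X ∖ q)
                               + removalChange (m (x - 1ℤ , y)) (m (x - 1ℤ , y - 1ℤ)) (m (x , y - 1ℤ)) (m (x + 1ℤ , y - 1ℤ))
  Ê-remove-lex-max a n X⊆box = trans (Ê-∖ a n X⊆box (proj₁ max)) (cong (λ s → Ê a n (X ∖ q) + s)
    (cong₂ _+_ at-q (cong₂ _+_ at-west (cong₂ _+_ at-south (trans (cong₂ _+_ at-south-west refl) (ℤ.+-identityʳ _))))))

-- Crossing parity

everyAssignment : (n : ℕ) → (Vec Bool n → Bool) → Bool
everyAssignment zero f = f []ᵛ
everyAssignment (suc n) f = everyAssignment n (λ v → f (true ∷ᵛ v)) ∧ everyAssignment n (λ v → f (false ∷ᵛ v))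

∧-elim : ∀ {a b} → a ∧ b ≡ true → a ≡ true × b ≡ true
∧-elim {true} {true} _ = refl , refl

∧-intro : ∀ {a b} → a ≡ true → b ≡ true → a ∧ b ≡ true
∧-intro refl refl = refl

everyAssignment-sound : ∀ n f → everyAssignment n f ≡ true → ∀ v → f v ≡ true
everyAssignment-sound zero f t []ᵛ = t
everyAssignment-sound (suc n) f t (true ∷ᵛ v) = everyAssignment-sound n _ (proj₁ (∧-elim t)) v
everyAssignment-sound (suc n) f t (false ∷ᵛ v) = everyAssignment-sound n _ (proj₂ (∧-elim {everyAssignment n _} t)) v

_⇒ᵇ_ : Bool → Bool → Bool
a ⇒ᵇ b = not a ∨ b

_≡ᵇ_ : Bool → Bool → Bool
a ≡ᵇ b = not (a xor b)

⇒ᵇ-elim : ∀ {a b} → a ⇒ᵇ b ≡ true → a ≡ true → b ≡ true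
⇒ᵇ-elim t refl = t

≡ᵇ⇒≡ : ∀ {a b} → a ≡ᵇ b ≡ true → a ≡ b
≡ᵇ⇒≡ {true} {true} _ = refl
≡ᵇ⇒≡ {false} {false} _ = refl

zeroᵇ oneᵇ twoᵇ positiveᵇ : ℤ → Bool
zeroᵇ (+ 0) = true
zeroᵇ _ = false
oneᵇ (+ 1) = true
oneᵇ _ = false
twoᵇ (+ 2) = true
twoᵇ _ = false
positiveᵇ (+ suc _) = true
positiveᵇ _ = false

zeroᵇ-sound : ∀ d → zeroᵇ d ≡ true → d ≡ 0ℤ
zeroᵇ-sound (+ 0) _ = refl

oneᵇ-sound : ∀ d → oneᵇ d ≡ true → d ≡ 1ℤ
oneᵇ-sound (+ 1) _ = refl

positiveᵇ-sound : ∀ d → positiveᵇ d ≡ true → 0ℤ < d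
positiveᵇ-sound (+ suc _) _ = +<+ (s≤s z≤n)

zeroᵇ-pred : ∀ d → zeroᵇ (d - 1ℤ) ≡ oneᵇ d
zeroᵇ-pred (+ 0) = refl
zeroᵇ-pred (+ 1) = refl
zeroᵇ-pred (+ suc (suc _)) = refl
zeroᵇ-pred -[1+ _ ] = refl

oneᵇ-pred : ∀ d → oneᵇ (d - 1ℤ) ≡ twoᵇ d
oneᵇ-pred (+ 0) = refl
oneᵇ-pred (+ 1) = refl
oneᵇ-pred (+ 2) = refl
oneᵇ-pred (+ suc (suc (suc _))) = refl
oneᵇ-pred -[1+ _ ] = refl

positiveᵇ-pred : ∀ d → positiveᵇ (d - 1ℤ) ≡ positiveᵇ d ∧ not (oneᵇ d)
positiveᵇ-pred (+ 0) = refl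
positiveᵇ-pred (+ 1) = refl
positiveᵇ-pred (+ suc (suc _)) = refl
positiveᵇ-pred -[1+ _ ] = refl

i-j≡0⇒i≡j : ∀ i j → zeroᵇ (i - j) ≡ true → i ≡ j
i-j≡0⇒i≡j i j t = ℤ.i-j≡0⇒i≡j i j (zeroᵇ-sound (i - j) t)

i-j≡1⇒i≡j+1 : ∀ i j → oneᵇ (i - j) ≡ true → i ≡ j + 1ℤ
i-j≡1⇒i≡j+1 i j t = trans (solve 2 (λ i j → i := j :+ (i :- j)) refl i j) (cong (λ d → j + d) (oneᵇ-sound (i - j) t))

i-j>0⇒j<i : ∀ i j → positiveᵇ (i - j) ≡ true → j < i
i-j>0⇒j<i i j t = subst₂ _<_ (ℤ.+-identityʳ j) (solve 2 (λ i j → j :+ (i :- j) := i) refl i j)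
                          (ℤ.+-monoʳ-< j (positiveᵇ-sound (i - j) t))

-- For a grid point g = (a , b) this says whether the step u → w crosses the vertical half-line
-- rising from g: one end lies in column a, the other in column a + 1, and the end in column a
-- lies above g.
crosses : GridPoint → Pixel → Pixel → Bool
crosses (a , b) (ux , uy) (wx , wy) =
  (zeroᵇ (ux - a) ∧ oneᵇ (wx - a) ∧ positiveᵇ (uy - b)) xor (zeroᵇ (wx - a) ∧ oneᵇ (ux - a) ∧ positiveᵇ (wy - b))

aboveᵇ : GridPoint → Pixel → Bool
aboveᵇ (a , b) (px , py) = oneᵇ (px - a) ∧ positiveᵇ (py - b)

ColumnFacts : Bool → Bool → Bool → Bool → Bool → Bool → Bool
ColumnFacts e₀ e₁ e₂ f₀ f₁ f₂ =
  not (e₀ ∧ e₁) ∧ not (e₀ ∧ e₂) ∧ not (e₁ ∧ e₂) ∧ not (f₀ ∧ f₁) ∧ not (f₀ ∧ f₂) ∧ not (f₁ ∧ f₂)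
  ∧ (e₀ ⇒ᵇ not f₂) ∧ (e₂ ⇒ᵇ not f₀) ∧ (e₁ ⇒ᵇ (f₀ ∨ f₁ ∨ f₂)) ∧ (f₁ ⇒ᵇ (e₀ ∨ e₁ ∨ e₂))

column-facts : ∀ s t → Near s t → ColumnFacts (zeroᵇ s) (oneᵇ s) (twoᵇ s) (zeroᵇ t) (oneᵇ t) (twoᵇ t) ≡ true
column-facts (+ 0) _ (inj₁ refl) = refl
column-facts (+ 0) _ (inj₂ (inj₁ refl)) = refl
column-facts (+ 0) _ (inj₂ (inj₂ refl)) = refl
column-facts (+ 1) _ (inj₁ refl) = refl
column-facts (+ 1) _ (inj₂ (inj₁ refl)) = refl
column-facts (+ 1) _ (inj₂ (inj₂ refl)) = refl
column-facts (+ 2) _ (inj₁ refl) = refl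
column-facts (+ 2) _ (inj₂ (inj₁ refl)) = refl
column-facts (+ 2) _ (inj₂ (inj₂ refl)) = refl
column-facts (+ 3) _ (inj₁ refl) = refl
column-facts (+ 3) _ (inj₂ (inj₁ refl)) = refl
column-facts (+ 3) _ (inj₂ (inj₂ refl)) = refl
column-facts (+ suc (suc (suc (suc _)))) _ (inj₁ refl) = refl
column-facts (+ suc (suc (suc (suc _)))) _ (inj₂ (inj₁ refl)) = refl
column-facts (+ suc (suc (suc (suc _)))) _ (inj₂ (inj₂ refl)) = refl
column-facts -[1+ 0 ] _ (inj₁ refl) = refl
column-facts -[1+ 0 ] _ (inj₂ (inj₁ refl)) = refl
column-facts -[1+ 0 ] _ (inj₂ (inj₂ refl)) = refl
column-facts -[1+ suc _ ] _ (inj₁ refl) = refl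
column-facts -[1+ suc _ ] _ (inj₂ (inj₁ refl)) = refl
column-facts -[1+ suc _ ] _ (inj₂ (inj₂ refl)) = refl

RowFacts : Bool → Bool → Bool → Bool → Bool
RowFacts p p′ z z′ = ((p ≡ᵇ p′) ∨ (p ∧ z′) ∨ (p′ ∧ z)) ∧ (z ⇒ᵇ not p) ∧ (z′ ⇒ᵇ not p′)

row-facts : ∀ r r′ → Near r r′ → RowFacts (positiveᵇ r) (positiveᵇ r′) (zeroᵇ r) (zeroᵇ r′) ≡ true
row-facts (+ 0) _ (inj₁ refl) = refl
row-facts (+ 0) _ (inj₂ (inj₁ refl)) = refl
row-facts (+ 0) _ (inj₂ (inj₂ refl)) = refl
row-facts (+ 1) _ (inj₁ refl) = refl
row-facts (+ 1) _ (inj₂ (inj₁ refl)) = refl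
row-facts (+ 1) _ (inj₂ (inj₂ refl)) = refl
row-facts (+ suc (suc _)) _ (inj₁ refl) = refl
row-facts (+ suc (suc _)) _ (inj₂ (inj₁ refl)) = refl
row-facts (+ suc (suc _)) _ (inj₂ (inj₂ refl)) = refl
row-facts -[1+ 0 ] _ (inj₁ refl) = refl
row-facts -[1+ 0 ] _ (inj₂ (inj₁ refl)) = refl
row-facts -[1+ 0 ] _ (inj₂ (inj₂ refl)) = refl
row-facts -[1+ suc _ ] _ (inj₁ refl) = refl
row-facts -[1+ suc _ ] _ (inj₂ (inj₁ refl)) = refl
row-facts -[1+ suc _ ] _ (inj₂ (inj₂ refl)) = refl

-- Here e₀ e₁ e₂ (f₀ f₁ f₂) say whether the step u → w starts (ends) in column a, a + 1 or a + 2,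
-- p, p′ whether its ends lie above row b and z, z′ whether they lie on row b.
horizontal-shift-identity : Vec Bool 10 → Bool
horizontal-shift-identity (e₀ ∷ᵛ e₁ ∷ᵛ e₂ ∷ᵛ f₀ ∷ᵛ f₁ ∷ᵛ f₂ ∷ᵛ p ∷ᵛ p′ ∷ᵛ z ∷ᵛ z′ ∷ᵛ []ᵛ) =
  (ColumnFacts e₀ e₁ e₂ f₀ f₁ f₂ ∧ RowFacts p p′ z z′
    ∧ not (e₀ ∧ z) ∧ not (e₁ ∧ z) ∧ not (f₀ ∧ z′) ∧ not (f₁ ∧ z′))
  ⇒ᵇ ((((e₀ ∧ f₁ ∧ p) xor (f₀ ∧ e₁ ∧ p′)) xor ((e₁ ∧ f₂ ∧ p) xor (f₁ ∧ e₂ ∧ p′))) ≡ᵇ ((e₁ ∧ p) xor (f₁ ∧ p′)))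

i-[j+1]≡i-j-1 : ∀ i j → i - (j + 1ℤ) ≡ (i - j) - 1ℤ
i-[j+1]≡i-j-1 = solve 2 (λ i j → i :- (j :+ con 1ℤ) := i :- j :- con 1ℤ) refl

near-shift : ∀ {u w} a → Near u w → Near (u - a) (w - a)
near-shift {u} a (inj₁ refl) = inj₁ (solve 2 (λ u a → u :- con 1ℤ :- a := u :- a :- con 1ℤ) refl u a)
near-shift a (inj₂ (inj₁ refl)) = inj₂ (inj₁ refl)
near-shift {u} a (inj₂ (inj₂ refl)) = inj₂ (inj₂ (solve 2 (λ u a → u :+ con 1ℤ :- a := u :- a :+ con 1ℤ) refl u a))

∧-excluded : ∀ b c → (b ≡ true → c ≡ true → ⊥) → b ∧ c ≡ false
∧-excluded true true excluded = ⊥-elim (excluded refl refl)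
∧-excluded true false _ = refl
∧-excluded false _ _ = refl

crosses-shift-right : ∀ a b {u w} → NearPixel u w →
                      u ≢ (a , b) → u ≢ (a + 1ℤ , b) → w ≢ (a , b) → w ≢ (a + 1ℤ , b) →
                      crosses (a , b) u w xor crosses (a + 1ℤ , b) u w ≡ aboveᵇ (a , b) u xor aboveᵇ (a , b) w
crosses-shift-right a b {ux , uy} {wx , wy} (nx , ny) u≢₀ u≢₁ w≢₀ w≢₁
  rewrite i-[j+1]≡i-j-1 ux a | i-[j+1]≡i-j-1 wx a | zeroᵇ-pred (ux - a) | oneᵇ-pred (ux - a)
        | zeroᵇ-pred (wx - a) | oneᵇ-pred (wx - a) =
  ≡ᵇ⇒≡ (⇒ᵇ-elim (everyAssignment-sound 10 horizontal-shift-identity refl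
           (zeroᵇ (ux - a) ∷ᵛ oneᵇ (ux - a) ∷ᵛ twoᵇ (ux - a) ∷ᵛ zeroᵇ (wx - a) ∷ᵛ oneᵇ (wx - a) ∷ᵛ twoᵇ (wx - a)
            ∷ᵛ positiveᵇ (uy - b) ∷ᵛ positiveᵇ (wy - b) ∷ᵛ zeroᵇ (uy - b) ∷ᵛ zeroᵇ (wy - b) ∷ᵛ []ᵛ))
    (∧-intro (column-facts (ux - a) (wx - a) (near-shift a nx))
    (∧-intro (row-facts (uy - b) (wy - b) (near-shift b ny))
    (∧-intro (cong not (∧-excluded _ _ (λ e z → u≢₀ (cong₂ _,_ (i-j≡0⇒i≡j ux a e) (i-j≡0⇒i≡j uy b z)))))
    (∧-intro (cong not (∧-excluded _ _ (λ e z → u≢₁ (cong₂ _,_ (i-j≡1⇒i≡j+1 ux a e) (i-j≡0⇒i≡j uy b z)))))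
    (∧-intro (cong not (∧-excluded _ _ (λ e z → w≢₀ (cong₂ _,_ (i-j≡0⇒i≡j wx a e) (i-j≡0⇒i≡j wy b z)))))
             (cong not (∧-excluded _ _ (λ e z → w≢₁ (cong₂ _,_ (i-j≡1⇒i≡j+1 wx a e) (i-j≡0⇒i≡j wy b z)))))))))))

crosses-shift-up : ∀ a b {u w} → u ≢ (a , b + 1ℤ) → w ≢ (a , b + 1ℤ) → crosses (a , b) u w ≡ crosses (a , b + 1ℤ) u w
crosses-shift-up a b {ux , uy} {wx , wy} u≢ w≢
  rewrite i-[j+1]≡i-j-1 uy b | i-[j+1]≡i-j-1 wy b | positiveᵇ-pred (uy - b) | positiveᵇ-pred (wy - b) =
  cong₂ _xor_
    (unaffected (zeroᵇ (ux - a)) (oneᵇ (wx - a)) (positiveᵇ (uy - b)) (oneᵇ (uy - b))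
                (λ e o → u≢ (cong₂ _,_ (i-j≡0⇒i≡j ux a e) (i-j≡1⇒i≡j+1 uy b o))))
    (unaffected (zeroᵇ (wx - a)) (oneᵇ (ux - a)) (positiveᵇ (wy - b)) (oneᵇ (wy - b))
                (λ e o → w≢ (cong₂ _,_ (i-j≡0⇒i≡j wx a e) (i-j≡1⇒i≡j+1 wy b o))))
  where
  unaffected : ∀ e f p o → (e ≡ true → o ≡ true → ⊥) → e ∧ f ∧ p ≡ e ∧ f ∧ (p ∧ not o)
  unaffected false _ _ _ _ = refl
  unaffected true false _ _ _ = refl
  unaffected true true false _ _ = refl
  unaffected true true true false _ = refl
  unaffected true true true true excluded = ⊥-elim (excluded refl refl)

xor-interchange : ∀ a b c d → (a xor b) xor (c xor d) ≡ (a xor c) xor (b xor d)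
xor-interchange a b c d = begin
  (a xor b) xor (c xor d)  ≡⟨ xor-assoc a b (c xor d) ⟩
  a xor (b xor (c xor d))  ≡⟨ cong (a xor_) (sym (xor-assoc b c d)) ⟩
  a xor ((b xor c) xor d)  ≡⟨ cong (λ t → a xor (t xor d)) (xor-comm b c) ⟩
  a xor ((c xor b) xor d)  ≡⟨ cong (a xor_) (xor-assoc c b d) ⟩
  a xor (c xor (b xor d))  ≡⟨ sym (xor-assoc a c (b xor d)) ⟩
  (a xor c) xor (b xor d)  ∎
  where open ≡-Reasoning

xor-cancel-middle : ∀ a b c → (a xor b) xor (b xor c) ≡ a xor c
xor-cancel-middle a b c = begin
  (a xor b) xor (b xor c)  ≡⟨ xor-assoc a b (b xor c) ⟩
  a xor (b xor (b xor c))  ≡⟨ cong (a xor_) (sym (xor-assoc b b c)) ⟩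
  a xor ((b xor b) xor c)  ≡⟨ cong (λ t → a xor (t xor c)) (xor-same b) ⟩
  a xor c                  ∎
  where open ≡-Reasoning

xor≡false⇒≡ : ∀ {a b} → a xor b ≡ false → a ≡ b
xor≡false⇒≡ {true} {true} _ = refl
xor≡false⇒≡ {false} {false} _ = refl

crossings : ∀ {S s t} → GridPoint → Path Adj0 S s t → Bool
crossings g (single _) = false
crossings g (step {u} {w} _ _ p) = crosses g u w xor crossings g p

crossings-++ : ∀ {S s t r} g (P : Path Adj0 S s t) (R : Path Adj0 S t r) →
               crossings g (P ++ᵖ R) ≡ crossings g P xor crossings g R
crossings-++ g (single _) R = refl
crossings-++ g (step {u} {w} _ _ p) R =
  trans (cong (crosses g u w xor_) (crossings-++ g p R)) (sym (xor-assoc (crosses g u w) (crossings g p) (crossings g R)))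

crossings-mono : ∀ {S S′ : Pixel → Set} {s t} g (f : ∀ z → S z → S′ z) (P : Path Adj0 S s t) →
                 crossings g (path-mono f P) ≡ crossings g P
crossings-mono g f (single _) = refl
crossings-mono g f (step {u} {w} _ _ p) = cong (crosses g u w xor_) (crossings-mono g f p)

crossings-shift-right : ∀ {S s t} a b (P : Path Adj0 S s t) → (∀ {z} → S z → z ≢ (a , b) × z ≢ (a + 1ℤ , b)) →
                        crossings (a , b) P xor crossings (a + 1ℤ , b) P ≡ aboveᵇ (a , b) s xor aboveᵇ (a , b) t
crossings-shift-right {s = s} a b (single _) avoids = sym (xor-same (aboveᵇ (a , b) s))
crossings-shift-right {t = t} a b (step {u} {w} su e p) avoids =
  trans (xor-interchange (crosses (a , b) u w) (crossings (a , b) p) (crosses (a + 1ℤ , b) u w) (crossings (a + 1ℤ , b) p))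
    (trans (cong₂ _xor_ (crosses-shift-right a b (adj0⇒near e) (proj₁ (avoids su)) (proj₂ (avoids su))
                                             (proj₁ (avoids (path-start p))) (proj₂ (avoids (path-start p))))
                        (crossings-shift-right a b p avoids))
           (xor-cancel-middle (aboveᵇ (a , b) u) (aboveᵇ (a , b) w) (aboveᵇ (a , b) t)))

crossings-shift-up : ∀ {S s t} a b (P : Path Adj0 S s t) → (∀ {z} → S z → z ≢ (a , b + 1ℤ)) →
                     crossings (a , b) P ≡ crossings (a , b + 1ℤ) P
crossings-shift-up a b (single _) avoids = refl
crossings-shift-up a b (step su e p) avoids =
  cong₂ _xor_ (crosses-shift-up a b (avoids su) (avoids (path-start p))) (crossings-shift-up a b p avoids)

∧-false-middle : ∀ e f p → e ∧ p ≡ false → e ∧ f ∧ p ≡ false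
∧-false-middle true true _ e∧p = e∧p
∧-false-middle true false _ _ = refl
∧-false-middle false _ _ _ = refl

no-crossing : ∀ a b u w → zeroᵇ (proj₁ u - a) ∧ positiveᵇ (proj₂ u - b) ≡ false →
              zeroᵇ (proj₁ w - a) ∧ positiveᵇ (proj₂ w - b) ≡ false → crosses (a , b) u w ≡ false
no-crossing a b (ux , uy) (wx , wy) u-clear w-clear
  rewrite ∧-false-middle (zeroᵇ (ux - a)) (oneᵇ (wx - a)) (positiveᵇ (uy - b)) u-clear
        | ∧-false-middle (zeroᵇ (wx - a)) (oneᵇ (ux - a)) (positiveᵇ (wy - b)) w-clear = refl

crossings-none : ∀ {S s t} a b (P : Path Adj0 S s t) →
                 (∀ {z} → S z → zeroᵇ (proj₁ z - a) ∧ positiveᵇ (proj₂ z - b) ≡ false) → crossings (a , b) P ≡ false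
crossings-none a b (single _) clear = refl
crossings-none a b (step {u} {w} su _ p) clear
  rewrite no-crossing a b u w (clear su) (clear (path-start p)) = crossings-none a b p clear

-- Discrete Jordan curve argument: for a closed path Q in X, the parity of the number of crossings of Q
-- with the half-line rising from the upper-right corner of a pixel z does not change when z moves to a
-- 1-adjacent pixel outside X, since the half-line then only sweeps over pixels not on Q.
module _ {X : List Pixel} {q : Pixel} (Q : Path Adj0 (InM X) q q) where

  parity : Pixel → Bool
  parity z = crossings z Q

  parity-step : ∀ {z z′} → Adj1 z z′ → z ∉ X → z′ ∉ X → parity z ≡ parity z′
  parity-step {x , y} {x′ , y′} z~z′ z∉ z′∉ with adj1-cases {x} {y} {x′} {y′} z~z′
  ... | inj₁ (inj₁ refl , refl) =
    xor≡false⇒≡ (trans (crossings-shift-right x y Q (λ z∈ → (λ { refl → z∉ z∈ }) , (λ { refl → z′∉ z∈ })))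
                       (xor-same (aboveᵇ (x , y) q)))
  ... | inj₁ (inj₂ refl , refl) =
    sym (trans (xor≡false⇒≡ (trans (crossings-shift-right (x - 1ℤ) y Q (λ z∈ → (λ { refl → z′∉ z∈ }) , left-of z∈))
                                   (xor-same (aboveᵇ (x - 1ℤ , y) q))))
               (cong (λ t → crossings (t , y) Q) (i-1+1≡i x)))
    where
    left-of : ∀ {p} → p ∈ X → p ≢ (x - 1ℤ + 1ℤ , y)
    left-of p∈ e = z∉ (subst (_∈ X) (trans e (cong (_, y) (i-1+1≡i x))) p∈)
  ... | inj₂ (refl , inj₁ refl) = crossings-shift-up x y Q (λ { z∈ refl → z′∉ z∈ })
  ... | inj₂ (refl , inj₂ refl) =
    sym (trans (crossings-shift-up x (y - 1ℤ) Q below-of) (cong (λ t → crossings (x , t) Q) (i-1+1≡i y)))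
    where
    below-of : ∀ {p} → p ∈ X → p ≢ (x , y - 1ℤ + 1ℤ)
    below-of p∈ e = z∉ (subst (_∈ X) (trans e (cong (x ,_) (i-1+1≡i y))) p∈)

  parity-path : ∀ {z w} → Conn1c X z w → parity z ≡ parity w
  parity-path (single _) = refl
  parity-path (step z∉ e p) = trans (parity-step e z∉ (path-start p)) (parity-path p)

  parity-above-box : ∀ a n → X ⊆ box a n → ∀ {w} → a + + n ≤ proj₂ w → parity w ≡ false
  parity-above-box a n X⊆box {wx , wy} high = crossings-none wx wy Q λ {u} u∈ →
    trans (cong (zeroᵇ (proj₁ u - wx) ∧_) (below u∈)) (∧-zeroʳ (zeroᵇ (proj₁ u - wx)))
    where
    below : ∀ {u} → u ∈ X → positiveᵇ (proj₂ u - wy) ≡ false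
    below {ux , uy} u∈ with positiveᵇ (uy - wy) in above
    ... | false = refl
    ... | true = contradiction (ℤ.<-≤-trans (range-upper a n (proj₂ (∈-box⁻ a n (X⊆box u∈)))) high)
                               (ℤ.<-asym (i-j>0⇒j<i uy wy above))

  odd-parity⇒enclosed : ∀ a n → X ⊆ box a n → ∀ {z} → parity z ≡ true → Finite (Conn1c X z)
  odd-parity⇒enclosed a n X⊆box {z} odd = box a n , enclosed
    where
    enclosed : ∀ w → Conn1c X z w → w ∈ box a n
    enclosed w z~w with w ∈? box a n
    ... | yes w∈ = w∈
    ... | no w∉ with escape-above a n X⊆box w∉
    ...   | e , w~e , high =
      contradiction (trans (sym odd) (trans (parity-path z~w) (trans (parity-path w~e) (parity-above-box a n X⊆box high))))
                    λ ()

-- Closing the path through q gives a closed path with an odd number of crossings above the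
-- south neighbour of q.
south-enclosed : ∀ {X x y} a n → X ⊆ box a n → IsLexMax X (x , y) →
                 ∀ {y′} → Adj0 (x , y) (x - 1ℤ , y′) → Path Adj0 (InM (X ∖ (x , y))) (x - 1ℤ , y′) (x + 1ℤ , y - 1ℤ) →
                 Finite (Conn1c X (x , y - 1ℤ))
south-enclosed {X} {x} {y} a n X⊆box max {y′} q~a′ P = odd-parity⇒enclosed Q a n X⊆box odd
  where
  q a′ SE : Pixel
  q = x , y
  a′ = x - 1ℤ , y′
  SE = x + 1ℤ , y - 1ℤ
  SE~q : Adj0 SE q
  SE~q = adj0-diagonal (x + 1ℤ) (y - 1ℤ) (near-suc⁻ x) (inj₂ (inj₂ (sym (i-1+1≡i y)))) (λ e → ℤ.<-irrefl e (i<i+1 x))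
  P′ : Path Adj0 (InM X) a′ SE
  P′ = path-mono (λ _ → ∖-⊆ X) P
  Q : Path Adj0 (InM X) q q
  Q = step (proj₁ max) q~a′ (path-snoc P′ SE~q (proj₁ max))
  g : GridPoint
  g = x , y - 1ℤ
  leaving : crosses g q a′ ≡ false
  leaving rewrite ℤ.+-inverseʳ x | solve 1 (λ x → x :- con 1ℤ :- x := con -1ℤ) refl x = refl
  returning : crosses g SE q ≡ true
  returning rewrite ℤ.+-inverseʳ x | solve 1 (λ x → x :+ con 1ℤ :- x := con 1ℤ) refl x
                  | solve 1 (λ y → y :- (y :- con 1ℤ) := con 1ℤ) refl y = refl
  below-or-left : ∀ {u} → u ∈ X ∖ q → zeroᵇ (proj₁ u - x) ∧ positiveᵇ (proj₂ u - (y - 1ℤ)) ≡ false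
  below-or-left {ux , uy} u∈ = ∧-excluded _ _ λ column above → excluded (i-j≡0⇒i≡j ux x column) (i-j>0⇒j<i uy (y - 1ℤ) above)
    where
    excluded : ux ≡ x → y - 1ℤ < uy → ⊥
    excluded refl y-1<uy with proj₂ max (∖-⊆ X u∈)
    ... | inj₁ uy<y =
      ℤ.<⇒≱ uy<y (subst (_≤ uy) (solve 1 (λ y → con 1ℤ :+ (y :- con 1ℤ) := y) refl y) (ℤ.i<j⇒suc[i]≤j y-1<uy))
    ... | inj₂ (refl , _) = ∉-∖ X u∈
  odd : parity Q g ≡ true
  odd = begin
    crosses g q a′ xor crossings g (P′ ++ᵖ step (path-end P′) SE~q (single (proj₁ max)))
      ≡⟨ cong₂ _xor_ leaving (crossings-++ g P′ _) ⟩
    crossings g P′ xor (crosses g SE q xor false)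
      ≡⟨ cong₂ (λ s t → s xor (t xor false))
               (trans (crossings-mono g _ P) (crossings-none x (y - 1ℤ) P below-or-left)) returning ⟩
    true ∎
    where open ≡-Reasoning

-- The lower bound 8 (c − h) ≤ Ê

module Representatives {D : Pixel → Set} {Conn : Pixel → Pixel → Set} {T : List Pixel} (t : Transversal D Conn T) where

  unique : Unique T
  unique = proj₁ t

  member : ∀ {r} → r ∈ T → D r
  member = proj₁ (proj₂ t) _

  identify : ∀ {r s} → r ∈ T → s ∈ T → Conn r s → r ≡ s
  identify {r} {s} r∈ s∈ r~s with r ≟ᵖ s
  ... | yes r≡s = r≡s
  ... | no r≢s = contradiction r~s (proj₁ (proj₂ (proj₂ t)) r s r∈ s∈ r≢s)

  representative : ∀ {z} → D z → ∃ λ r → r ∈ T × Conn z r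
  representative = proj₂ (proj₂ (proj₂ t)) _

conn0-∖ : ∀ {X q u v} → Conn0 (X ∖ q) u v → Conn0 X u v
conn0-∖ {X} = path-mono (λ _ → ∖-⊆ X)

conn1c-∖ : ∀ {X q u v} → Conn1c X u v → Conn1c (X ∖ q) u v
conn1c-∖ {X} = path-mono (λ _ z∉ z∈ → z∉ (∖-⊆ X z∈))

module Removal {X : List Pixel} {x y : ℤ} (max : IsLexMax X (x , y)) {C H C′ H′ : List Pixel}
               (tC : Transversal (InM X) (Conn0 X) C) (tH : Transversal (InFiniteHole X) (Conn1c X) H)
               (tC′ : Transversal (InM (X ∖ (x , y))) (Conn0 (X ∖ (x , y))) C′)
               (tH′ : Transversal (InFiniteHole (X ∖ (x , y))) (Conn1c (X ∖ (x , y))) H′) where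

  private
    q : Pixel
    q = x , y

    X′ : List Pixel
    X′ = X ∖ q

    module C = Representatives tC
    module H = Representatives tH
    module C′ = Representatives tC′
    module H′ = Representatives tH′

    q∈X : q ∈ X
    q∈X = proj₁ max

    stays : ∀ {z} → z ∈ X → z ≢ q → z ∈ X′
    stays = ∈-∖⁺

    q-unbounded : ¬ Finite (Conn1c X′ q)
    q-unbounded = upward-ray-infinite X′ x y free
      where
      free : ∀ k → (x , y + + k) ∉ X′
      free zero q∈ = ∉-∖ X (subst (λ t → (x , t) ∈ X′) (ℤ.+-identityʳ y) q∈)
      free (suc k) p∈ = above-lex-max-free max (i<i+[1+k] y k) (∖-⊆ X p∈)

    hole′⇒hole : ∀ {h} → InFiniteHole X′ h → InFiniteHole X h
    hole′⇒hole {h} (h∉X′ , L , covers) = h∉X , L , λ z h~z → covers z (conn1c-∖ h~z)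
      where
      h∉X : h ∉ X
      h∉X h∈ with h ≟ᵖ q
      ... | yes refl = q-unbounded (L , covers)
      ... | no h≢q = h∉X′ (stays h∈ h≢q)

    holes-meet : ∀ {h₁ h₂ r} → h₁ ∈ H′ → h₂ ∈ H′ → Conn1c X h₁ r → Conn1c X h₂ r → h₁ ≡ h₂
    holes-meet h₁∈ h₂∈ h₁~r h₂~r = H′.identify h₁∈ h₂∈ (conn1c-∖ (h₁~r ++ᵖ conn1-sym h₂~r))

    components-meet : ∀ {r₁ r₂ s} → r₁ ∈ C → r₂ ∈ C → Conn0 X r₁ s → Conn0 X r₂ s → r₁ ≡ r₂
    components-meet r₁∈ r₂∈ r₁~s r₂~s = C.identify r₁∈ r₂∈ (r₁~s ++ᵖ conn0-sym r₂~s)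

    toward : ∀ {r p} → r ∈ C → p ∈ X′ → Adj0 q p → ∃ λ s → s ∈ C′ × Conn0 X r s
    toward {r} r∈ p∈ q~p with r ≟ᵖ q | C′.representative p∈
    ... | yes refl | s , s∈ , p~s = s , s∈ , step q∈X q~p (conn0-∖ p~s)
    ... | no r≢q | _ with C′.representative (stays (C.member r∈) r≢q)
    ...   | s , s∈ , r~s = s , s∈ , conn0-∖ r~s

  holes-≤ : length H′ ℕ.≤ length H
  holes-≤ = injective-relation⇒length≤ (Conn1c X) H′ H H′.unique H.unique
    (λ h∈ → pure (H.representative (hole′⇒hole (H′.member h∈)))) holes-meet

  components-≤ : ∀ {p} → p ∈ X′ → Adj0 q p → length C ℕ.≤ length C′
  components-≤ p∈ q~p = injective-relation⇒length≤ (Conn0 X) C C′ C.unique C′.unique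
    (λ r∈ → pure (toward r∈ p∈ q~p)) components-meet

  components-≤-suc : length C ℕ.≤ suc (length C′)
  components-≤-suc = injective-relation⇒length≤ (Conn0 X) C (q ∷ C′) C.unique
    (All.tabulate (λ s∈ q≡s → ∉-∖ X (subst (_∈ X′) (sym q≡s) (C′.member s∈))) ∷ C′.unique) total components-meet
    where
    total : ∀ {r} → r ∈ C → DoubleNegation (∃ λ s → s ∈ q ∷ C′ × Conn0 X r s)
    total {r} r∈ with r ≟ᵖ q
    ... | yes refl = pure (q , here refl , single q∈X)
    ... | no r≢q with C′.representative (stays (C.member r∈) r≢q)
    ...   | s , s∈ , r~s = pure (s , there s∈ , conn0-∖ r~s)

  components-split : ∀ {p p′} → p ∈ X′ → p′ ∈ X′ → Adj0 q p → Adj0 q p′ → ¬ Conn0 X′ p p′ →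
                     suc (length C) ℕ.≤ length C′
  components-split {p} {p′} p∈ p′∈ q~p q~p′ apart with C′.representative p′∈
  ... | r′ , r′∈ , p′~r′ = injective-relation-missing⇒length< R C C′ C.unique C′.unique total
    (λ r₁∈ r₂∈ R₁ R₂ → components-meet r₁∈ r₂∈ (proj₁ R₁) (proj₁ R₂)) r′∈ (λ _ R → proj₂ R refl)
    where
    R : Pixel → Pixel → Set
    R r s = Conn0 X r s × s ≢ r′
    total : ∀ {r} → r ∈ C → DoubleNegation (∃ λ s → s ∈ C′ × R r s)
    total {r} r∈ = do
      r~q? ← ¬¬-excluded-middle
      pure (choose r~q?)
      where
      choose : Dec (Conn0 X r q) → ∃ λ s → s ∈ C′ × R r s
      choose (yes r~q) with C′.representative p∈
      ... | s , s∈ , p~s = s , s∈ , r~q ++ᵖ step q∈X q~p (conn0-∖ p~s) ,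
                            λ { refl → apart (p~s ++ᵖ conn0-sym p′~r′) }
      choose (no r≁q) with C′.representative (stays (C.member r∈) (λ { refl → r≁q (single q∈X) }))
      ... | s , s∈ , r~s = s , s∈ , conn0-∖ r~s ,
                            λ { refl → r≁q (conn0-∖ (r~s ++ᵖ conn0-sym p′~r′)
                                             ++ᵖ conn0-sym (step q∈X q~p′ (single (∖-⊆ X p′∈)))) }

  holes-split : (x , y - 1ℤ) ∉ X → Finite (Conn1c X (x , y - 1ℤ)) → suc (length H′) ℕ.≤ length H
  holes-split S∉ S-finite with H.representative (S∉ , S-finite)
  ... | r₀ , r₀∈ , S~r₀ = injective-relation-missing⇒length< R H′ H H′.unique H.unique total
    (λ h₁∈ h₂∈ R₁ R₂ → holes-meet h₁∈ h₂∈ (proj₁ R₁) (proj₁ R₂)) r₀∈ (λ _ R → proj₂ R refl)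
    where
    R : Pixel → Pixel → Set
    R h s = Conn1c X h s × s ≢ r₀
    S~q : Conn1c X′ (x , y - 1ℤ) q
    S~q = step (λ S∈ → S∉ (∖-⊆ X S∈)) (subst (λ t → Adj1 (x , y - 1ℤ) (x , t)) (i-1+1≡i y) (adj1-up x (y - 1ℤ)))
               (single (∉-∖ X))
    total : ∀ {h} → h ∈ H′ → DoubleNegation (∃ λ s → s ∈ H × R h s)
    total h∈ with H.representative (hole′⇒hole (H′.member h∈))
    ... | s , s∈ , h~s = pure (s , s∈ , h~s , λ { refl →
          q-unbounded (finite-along (conn1c-∖ (h~s ++ᵖ conn1-sym S~r₀) ++ᵖ S~q) (proj₂ (H′.member h∈))) })

count-step : ∀ {c h c′ h′} i j k l → i ℕ.+ c ℕ.≤ j ℕ.+ c′ → k ℕ.+ h′ ℕ.≤ l ℕ.+ h →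
             + c - + h ≤ + c′ - + h′ + ((+ j - + i) + (+ l - + k))
count-step {c} {h} {c′} {h′} i j k l cs hs with ℕ.m≤n⇒∃[o]m+o≡n cs | ℕ.m≤n⇒∃[o]m+o≡n hs
... | u , i+c+u≡j+c′ | v , k+h′+v≡l+h = subst (+ c - + h ≤_) (sym rearranged) (ℤ.i≤i+j (+ c - + h) (+ (u ℕ.+ v)))
  where
  open ≡-Reasoning
  lift : ∀ a b d {e} → a ℕ.+ b ℕ.+ d ≡ e → + a + + b + + d ≡ + e
  lift a b d eq = trans (sym (trans (ℤ.pos-+ (a ℕ.+ b) d) (cong (_+ + d) (ℤ.pos-+ a b)))) (cong +_ eq)
  rearranged : + c′ - + h′ + ((+ j - + i) + (+ l - + k)) ≡ + c - + h + + (u ℕ.+ v)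
  rearranged = begin
    + c′ - + h′ + ((+ j - + i) + (+ l - + k))
      ≡⟨ solve 7 (λ c′ h′ j i l k h → c′ :- h′ :+ ((j :- i) :+ (l :- k))
                                     := ((j :+ c′) :- i :- h) :+ ((l :+ h) :- k :- h′))
               refl (+ c′) (+ h′) (+ j) (+ i) (+ l) (+ k) (+ h) ⟩
    (+ (j ℕ.+ c′) - + i - + h) + (+ (l ℕ.+ h) - + k - + h′)
      ≡⟨ cong₂ (λ s t → (s - + i - + h) + (t - + k - + h′)) (sym (lift i c u i+c+u≡j+c′)) (sym (lift k h′ v k+h′+v≡l+h)) ⟩
    (+ i + + c + + u - + i - + h) + (+ k + + h′ + + v - + k - + h′)
      ≡⟨ solve 7 (λ i c u h k h′ v → (i :+ c :+ u :- i :- h) :+ (k :+ h′ :+ v :- k :- h′) := c :- h :+ (u :+ v))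
               refl (+ i) (+ c) (+ u) (+ h) (+ k) (+ h′) (+ v) ⟩
    + c - + h + (+ u + + v)
      ≡⟨ cong (λ s → + c - + h + s) (sym (ℤ.pos-+ u v)) ⟩
    + c - + h + + (u ℕ.+ v) ∎

removalChange-south : ∀ bW bSW bSE → removalChange bW bSW true bSE ≡ 0ℤ
removalChange-south true true true = refl
removalChange-south true true false = refl
removalChange-south true false true = refl
removalChange-south true false false = refl
removalChange-south false true true = refl
removalChange-south false true false = refl
removalChange-south false false true = refl
removalChange-south false false false = refl

module _ {X : List Pixel} {x y : ℤ} (a : ℤ) (n : ℕ) (X⊆box : X ⊆ box a n) (max : IsLexMax X (x , y))
         {C H C′ H′ : List Pixel}
         (tC : Transversal (InM X) (Conn0 X) C) (tH : Transversal (InFiniteHole X) (Conn1c X) H)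
         (tC′ : Transversal (InM (X ∖ (x , y))) (Conn0 (X ∖ (x , y))) C′)
         (tH′ : Transversal (InFiniteHole (X ∖ (x , y))) (Conn1c (X ∖ (x , y))) H′)
         (induction : + 8 * (+ length C′ - + length H′) ≤ Ê a n (X ∖ (x , y))) where

  open Removal max tC tH tC′ tH′

  private
    q W SW S SE : Pixel
    q = x , y
    W = x - 1ℤ , y
    SW = x - 1ℤ , y - 1ℤ
    S = x , y - 1ℤ
    SE = x + 1ℤ , y - 1ℤ

    Bound : ℤ → Set
    Bound Δ = + 8 * (+ length C - + length H) ≤ Ê a n (X ∖ q) + Δ

    conclude : ∀ i j k l → i ℕ.+ length C ℕ.≤ j ℕ.+ length C′ → k ℕ.+ length H′ ℕ.≤ l ℕ.+ length H →
               ∀ {Δ} → Δ ≡ + 8 * ((+ j - + i) + (+ l - + k)) → Bound Δ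
    conclude i j k l cs hs refl = begin
      + 8 * (+ length C - + length H)  ≤⟨ ℤ.*-monoˡ-≤-nonNeg (+ 8) (count-step i j k l cs hs) ⟩
      + 8 * (+ length C′ - + length H′ + δ)  ≡⟨ ℤ.*-distribˡ-+ (+ 8) (+ length C′ - + length H′) δ ⟩
      + 8 * (+ length C′ - + length H′) + + 8 * δ  ≤⟨ ℤ.+-monoˡ-≤ (+ 8 * δ) induction ⟩
      Ê a n (X ∖ q) + + 8 * δ  ∎
      where
      open ℤ.≤-Reasoning
      δ : ℤ
      δ = (+ j - + i) + (+ l - + k)

    present : ∀ p → p ∈ᵇ X ≡ true → p ≢ q → p ∈ X ∖ q
    present p p∈ᵇ p≢q = ∈-∖⁺ {X} (∈ᵇ⇒∈ {p} {X} p∈ᵇ) p≢q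

    x≢x-1 : x - 1ℤ ≢ x
    x≢x-1 e = i≢i-1 x (sym e)

    below≢q : ∀ i → (i , y - 1ℤ) ≢ q
    below≢q _ e = i≢i-1 y (sym (cong proj₂ e))

    W≢q : W ≢ q
    W≢q e = x≢x-1 (cong proj₁ e)

    q~W : Adj0 q W
    q~W = adj1⇒adj0 (adj1-left x y)

    q~SW : Adj0 q SW
    q~SW = adj0-diagonal x y (near-pred x) (near-pred y) x≢x-1

    q~S : Adj0 q S
    q~S = adj1⇒adj0 (adj1-down x y)

    q~SE : Adj0 q SE
    q~SE = adj0-diagonal x y (near-suc x) (near-pred y) (λ e → ℤ.<-irrefl (sym e) (i<i+1 x))

    join : ∀ {p} → p ∈ X ∖ q → Adj0 q p → ∀ {Δ} → Δ ≡ 0ℤ → Bound Δ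
    join p∈ q~p Δ≡0 = conclude 0 0 0 0 (components-≤ p∈ q~p) holes-≤ Δ≡0

    bridge : ∀ {y′} → (x - 1ℤ , y′) ∈ X ∖ q → Adj0 q (x - 1ℤ , y′) → SE ∈ X ∖ q → S ∉ X →
             DoubleNegation (Bound (+ 8 * -1ℤ))
    bridge a′∈ q~a′ SE∈ S∉ = do
      joined? ← ¬¬-excluded-middle
      pure (bridge-cases joined?)
      where
      bridge-cases : Dec (Conn0 (X ∖ q) (x - 1ℤ , _) SE) → Bound (+ 8 * -1ℤ)
      bridge-cases (yes a′~SE) =
        conclude 0 0 1 0 (components-≤ a′∈ q~a′) (holes-split S∉ (south-enclosed a n X⊆box max q~a′ a′~SE)) refl
      bridge-cases (no apart) = conclude 1 0 0 0 (components-split a′∈ SE∈ q~a′ q~SE apart) holes-≤ refl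

    by-neighbours : ∀ bW bSW bS bSE → W ∈ᵇ X ≡ bW → SW ∈ᵇ X ≡ bSW → S ∈ᵇ X ≡ bS → SE ∈ᵇ X ≡ bSE →
            DoubleNegation (Bound (removalChange bW bSW bS bSE))
    by-neighbours bW bSW true bSE _ _ S∈ _ = pure (join (present S S∈ (below≢q x)) q~S (removalChange-south bW bSW bSE))
    by-neighbours false false false false _ _ _ _ = pure (conclude 0 1 0 0 components-≤-suc holes-≤ refl)
    by-neighbours false false false true _ _ _ SE∈ = pure (join (present SE SE∈ (below≢q _)) q~SE refl)
    by-neighbours false true false false _ SW∈ _ _ = pure (join (present SW SW∈ (below≢q _)) q~SW refl)
    by-neighbours true false false false W∈ _ _ _ = pure (join (present W W∈ W≢q) q~W refl)
    by-neighbours true true false false W∈ _ _ _ = pure (join (present W W∈ W≢q) q~W refl)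
    by-neighbours false true false true _ SW∈ S∉ SE∈ = bridge (present SW SW∈ (below≢q _)) q~SW (present SE SE∈ (below≢q _)) (∈ᵇ⇒∉ S∉)
    by-neighbours true false false true W∈ _ S∉ SE∈ =
      bridge (present W W∈ W≢q) q~W (present SE SE∈ (below≢q _)) (∈ᵇ⇒∉ S∉)
    by-neighbours true true false true W∈ _ S∉ SE∈ =
      bridge (present W W∈ W≢q) q~W (present SE SE∈ (below≢q _)) (∈ᵇ⇒∉ S∉)

  removal-bound : DoubleNegation (+ 8 * (+ length C - + length H) ≤ Ê a n X)
  removal-bound = do
    bounded ← by-neighbours (W ∈ᵇ X) (SW ∈ᵇ X) (S ∈ᵇ X) (SE ∈ᵇ X) refl refl refl refl
    pure (subst (+ 8 * (+ length C - + length H) ≤_) (sym (Ê-remove-lex-max max a n X⊆box)) bounded)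

transversal-empty : ∀ {D Conn T} → (∀ {z} → ¬ D z) → Transversal D Conn T → T ≡ []
transversal-empty {T = []} _ _ = refl
transversal-empty {T = r ∷ _} nothing t = contradiction (proj₁ (proj₂ t) r (here refl)) nothing

Ê-lower-bound : ∀ a n X → Unique X → X ⊆ box a n → ∀ {C H} →
                Transversal (InM X) (Conn0 X) C → Transversal (InFiniteHole X) (Conn1c X) H →
                + 8 * (+ length C - + length H) ≤ Ê a n X
Ê-lower-bound a n X₀ = bound X₀ (ℕ.<-wellFounded (length X₀))
  where
  bound : ∀ X → Acc ℕ._<_ (length X) → Unique X → X ⊆ box a n → ∀ {C H} →
          Transversal (InM X) (Conn0 X) C → Transversal (InFiniteHole X) (Conn1c X) H →
          + 8 * (+ length C - + length H) ≤ Ê a n X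
  bound [] _ _ _ tC tH
    rewrite transversal-empty (λ ()) tC
          | transversal-empty (λ { {x , y} (_ , finite) → upward-ray-infinite [] x y (λ _ ()) finite }) tH
          | ∑-zero (vertexBox a n) {weightAt (_∈ᵇ [])} (λ _ → refl) = ℤ.≤-refl
  bound X@(x₀ ∷ xs) (acc smaller) uX X⊆box tC tH with lex-max-exists x₀ xs
  ... | q , max = decidable-stable (_ ℤ.≤? _) do
    C′ , tC′ ← components-exist (X ∖ q)
    H′ , tH′ ← holes-exist (X ∖ q) a n (λ p∈ → X⊆box (∖-⊆ X p∈))
    removal-bound a n X⊆box max tC tH tC′ tH′
      (bound (X ∖ q) (smaller (length-∖ uX (proj₁ max))) (unique-∖ q uX) (λ p∈ → X⊆box (∖-⊆ X p∈)) tC′ tH′)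

-- The complement of M in a box

inRange : ℤ → ℕ → ℤ → Bool
inRange a n t = does (t ∈ℤ? range a n)

∈ᵇ-box : ∀ a n x y → (x , y) ∈ᵇ box a n ≡ inRange a n x ∧ inRange a n y
∈ᵇ-box a n x y with (x , y) ∈? box a n | x ∈ℤ? range a n | y ∈ℤ? range a n
... | yes _ | yes _ | yes _ = refl
... | yes p∈ | no x∉ | _ = contradiction (proj₁ (∈-box⁻ a n p∈)) x∉
... | yes p∈ | yes _ | no y∉ = contradiction (proj₂ (∈-box⁻ a n p∈)) y∉
... | no p∉ | yes x∈ | yes y∈ = contradiction (∈-box⁺ a n x∈ y∈) p∉
... | no _ | no _ | _ = refl
... | no _ | yes _ | no _ = refl

weight-product : ∀ a₀ a₁ b₀ b₁ →
                 weight (a₀ ∧ b₀) (a₁ ∧ b₀) (a₀ ∧ b₁) (a₁ ∧ b₁) ≡ + 2 * (indicator (a₀ xor a₁) * indicator (b₀ xor b₁))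
weight-product true true true true = refl
weight-product true true true false = refl
weight-product true true false true = refl
weight-product true true false false = refl
weight-product true false true true = refl
weight-product true false true false = refl
weight-product true false false true = refl
weight-product true false false false = refl
weight-product false true true true = refl
weight-product false true true false = refl
weight-product false true false true = refl
weight-product false true false false = refl
weight-product false false true true = refl
weight-product false false true false = refl
weight-product false false false true = refl
weight-product false false false false = refl

module _ (lo : ℤ) (n₀ : ℕ) where

  private
    r : ℤ → Bool
    r = inRange lo (suc n₀)

    inside : ∀ {t} → t ∈ range lo (suc n₀) → r t ≡ true
    inside {t} = dec-true (t ∈ℤ? range lo (suc n₀))

    outside : ∀ {t} → t ∉ range lo (suc n₀) → r t ≡ false
    outside {t} = dec-false (t ∈ℤ? range lo (suc n₀))

  boundary : ℤ → ℤ
  boundary t = indicator (r t xor r (t + 1ℤ))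

  private
    below-end : ∀ {j m} → j ℕ.+ suc m ≡ suc n₀ → j ℕ.< suc n₀
    below-end {j} eq = subst (j ℕ.<_) eq (ℕ.m<m+n j (s≤s z≤n))

    shift : ∀ {j m} → j ℕ.+ suc (suc m) ≡ suc n₀ → suc j ℕ.+ suc m ≡ suc n₀
    shift {j} {m} eq = trans (sym (ℕ.+-suc j (suc m))) eq

    boundary-value : ∀ {t b₀ b₁} → r t ≡ b₀ → r (t + 1ℤ) ≡ b₁ → boundary t ≡ indicator (b₀ xor b₁)
    boundary-value r₀ r₁ = cong₂ (λ b₀ b₁ → indicator (b₀ xor b₁)) r₀ r₁

    ∑-boundary-from : ∀ m j → j ℕ.+ suc m ≡ suc n₀ → ∑ (range (lo + + j) (suc m)) boundary ≡ 1ℤ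
    ∑-boundary-from zero j j+1≡n = cong (_+ 0ℤ) (boundary-value (inside (∈-range⁺ lo (below-end j+1≡n)))
      (outside (above-range lo (suc n₀) (ℤ.≤-reflexive
         (trans (cong (λ k → lo + + k) (sym (trans (ℕ.+-comm 1 j) j+1≡n))) (i+[1+k]≡i+k+1 lo j))))))
    ∑-boundary-from (suc m) j j+m+2≡n = begin
      boundary (lo + + j) + ∑ (range (lo + + j + 1ℤ) (suc m)) boundary
        ≡⟨ cong₂ _+_ (boundary-value (inside (∈-range⁺ lo (below-end j+m+2≡n)))
                                     (inside (subst (_∈ range lo (suc n₀)) (i+[1+k]≡i+k+1 lo j)
                                                    (∈-range⁺ lo (below-end (shift j+m+2≡n))))))
                     (cong (λ t → ∑ (range t (suc m)) boundary) (sym (i+[1+k]≡i+k+1 lo j))) ⟩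
      0ℤ + ∑ (range (lo + + suc j) (suc m)) boundary
        ≡⟨ trans (ℤ.+-identityˡ _) (∑-boundary-from m (suc j) (shift j+m+2≡n)) ⟩
      1ℤ ∎
      where open ≡-Reasoning

  ∑-boundary : ∑ (range (lo - 1ℤ) (suc (suc n₀))) boundary ≡ + 2
  ∑-boundary = cong₂ _+_
    (boundary-value (outside (below-range lo (suc n₀) (i-1<i lo))) (trans (cong r (i-1+1≡i lo)) (inside (here refl))))
    (trans (cong (λ t → ∑ (range t (suc n₀)) boundary) (trans (i-1+1≡i lo) (sym (ℤ.+-identityʳ lo))))
           (∑-boundary-from n₀ 0 refl))

  Ê-box : Ê lo (suc n₀) (box lo (suc n₀)) ≡ + 8
  Ê-box = begin
    ∑ G (weightAt (_∈ᵇ box lo (suc n₀)))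
      ≡⟨ ∑-cong G (λ {v} _ → factor v) ⟩
    ∑ G (λ v → + 2 * (boundary (proj₁ v) * boundary (proj₂ v)))
      ≡⟨ ∑-*ˡ G (+ 2) (λ v → boundary (proj₁ v) * boundary (proj₂ v)) ⟩
    + 2 * ∑ G (λ v → boundary (proj₁ v) * boundary (proj₂ v))
      ≡⟨ cong (+ 2 *_) (∑-cartesianProduct R R boundary boundary) ⟩
    + 2 * (∑ R boundary * ∑ R boundary)
      ≡⟨ cong (λ s → + 2 * (s * s)) ∑-boundary ⟩
    + 8 ∎
    where
    open ≡-Reasoning
    R : List ℤ
    R = range (lo - 1ℤ) (suc (suc n₀))
    G : List GridPoint
    G = vertexBox lo (suc n₀)
    factor : ∀ v → weightAt (_∈ᵇ box lo (suc n₀)) v ≡ + 2 * (boundary (proj₁ v) * boundary (proj₂ v))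
    factor (i , j) = trans
      (weightAt-≡ (_∈ᵇ box lo (suc n₀)) (i , j) (∈ᵇ-box lo (suc n₀) i j) (∈ᵇ-box lo (suc n₀) (i + 1ℤ) j)
                            (∈ᵇ-box lo (suc n₀) i (j + 1ℤ)) (∈ᵇ-box lo (suc n₀) (i + 1ℤ) (j + 1ℤ)))
      (weight-product (r i) (r (i + 1ℤ)) (r j) (r (j + 1ℤ)))

weight-complement : ∀ c₁ c₂ c₃ c₄ →
                    weight (not c₁) (not c₂) (not c₃) (not c₄) + weight c₁ c₂ c₃ c₄
                    ≡ - (+ 8 * indicator (diagonal c₁ c₂ c₃ c₄))
weight-complement true true true true = refl
weight-complement true true true false = refl
weight-complement true true false true = refl
weight-complement true true false false = refl
weight-complement true false true true = refl
weight-complement true false true false = refl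
weight-complement true false false true = refl
weight-complement true false false false = refl
weight-complement false true true true = refl
weight-complement false true true false = refl
weight-complement false true false true = refl
weight-complement false true false false = refl
weight-complement false false true true = refl
weight-complement false false true false = refl
weight-complement false false false true = refl
weight-complement false false false false = refl

∨-false⁴ : ∀ a b c d → a ∨ b ∨ c ∨ d ≡ false → a ≡ false × b ≡ false × c ≡ false × d ≡ false
∨-false⁴ false false false false _ = refl , refl , refl , refl
∨-false⁴ true _ _ _ ()
∨-false⁴ false true _ _ ()
∨-false⁴ false false true _ ()
∨-false⁴ false false false true ()

vertex-corners-near : ∀ {v q} → IsVertexOf v q →
                      NearPixel q (sw v) × NearPixel q (se v) × NearPixel q (nw v) × NearPixel q (ne v)
vertex-corners-near (i≡ , j≡) = (near i≡ , near j≡) , (near⁺ i≡ , near j≡) , (near i≡ , near⁺ j≡) , (near⁺ i≡ , near⁺ j≡)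
  where
  near : ∀ {s t} → s ≡ t ⊎ s ≡ t - 1ℤ → Near t s
  near (inj₁ refl) = near-refl _
  near (inj₂ refl) = near-pred _
  near⁺ : ∀ {s t} → s ≡ t ⊎ s ≡ t - 1ℤ → Near t (s + 1ℤ)
  near⁺ (inj₁ refl) = near-suc _
  near⁺ {t = t} (inj₂ refl) = inj₂ (inj₁ (i-1+1≡i t))

module Complement (M : List Pixel) (a : ℤ) (n₀ : ℕ) (inner : ∀ {m} → m ∈ M → ∀ {p} → NearPixel m p → p ∈ box a (suc n₀))
                  (no-tunnel : ∀ w → ¬ IsZeroTunnel M w) where

  n : ℕ
  n = suc n₀

  N : List Pixel
  N = filter (λ p → ¬? (p ∈? M)) (box a n)

  N⊆box : N ⊆ box a n
  N⊆box p∈ = proj₁ (∈-filter⁻ (λ p → ¬? (p ∈? M)) {xs = box a n} p∈)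

  N∌M : ∀ {p} → p ∈ N → p ∉ M
  N∌M p∈ = proj₂ (∈-filter⁻ (λ p → ¬? (p ∈? M)) {xs = box a n} p∈)

  ∈-N⁺ : ∀ {p} → p ∈ box a n → p ∉ M → p ∈ N
  ∈-N⁺ = ∈-filter⁺ (λ p → ¬? (p ∈? M))

  unique-N : Unique N
  unique-N = Unique.filter⁺ (λ p → ¬? (p ∈? M)) {box a n} (unique-box a n)

  M⊆box : M ⊆ box a n
  M⊆box m∈ = inner m∈ (near-refl _ , near-refl _)

  ∈ᵇ-N-inside : ∀ {p} → p ∈ box a n → p ∈ᵇ N ≡ not (p ∈ᵇ M)
  ∈ᵇ-N-inside {p} p∈box with p ∈? N | p ∈? M
  ... | yes p∈N | yes p∈M = contradiction p∈M (N∌M p∈N)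
  ... | yes _ | no _ = refl
  ... | no _ | yes _ = refl
  ... | no p∉N | no p∉M = contradiction (∈-N⁺ p∈box p∉M) p∉N

  ∈ᵇ-N-outside : ∀ {p} → p ∉ M → p ∈ᵇ N ≡ p ∈ᵇ box a n
  ∈ᵇ-N-outside p∉M = ∈ᵇ-cong N⊆box (λ p∈ → ∈-N⁺ p∈ p∉M)

  weight-duality : ∀ v → weightAt (_∈ᵇ N) v + weightAt (_∈ᵇ M) v ≡ weightAt (_∈ᵇ box a n) v
  weight-duality v = by-contact (anyCorner (_∈ᵇ M) v) refl
    where
    open ≡-Reasoning
    m₁ m₂ m₃ m₄ : Bool
    m₁ = sw v ∈ᵇ M
    m₂ = se v ∈ᵇ M
    m₃ = nw v ∈ᵇ M
    m₄ = ne v ∈ᵇ M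
    by-contact : ∀ b → anyCorner (_∈ᵇ M) v ≡ b → weightAt (_∈ᵇ N) v + weightAt (_∈ᵇ M) v ≡ weightAt (_∈ᵇ box a n) v
    by-contact true touches with T-any⁻ M {v} (subst T (sym touches) tt)
    ... | q , q∈ , vertex with vertex-corners-near vertex
    ...   | n₁ , n₂ , n₃ , n₄ = begin
      weightAt (_∈ᵇ N) v + weightAt (_∈ᵇ M) v
        ≡⟨ cong (_+ weightAt (_∈ᵇ M) v) (weightAt-≡ (_∈ᵇ N) v (∈ᵇ-N-inside (inner q∈ n₁)) (∈ᵇ-N-inside (inner q∈ n₂))
                                                              (∈ᵇ-N-inside (inner q∈ n₃)) (∈ᵇ-N-inside (inner q∈ n₄))) ⟩
      weight (not m₁) (not m₂) (not m₃) (not m₄) + weight m₁ m₂ m₃ m₄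
        ≡⟨ weight-complement m₁ m₂ m₃ m₄ ⟩
      - (+ 8 * indicator (diagonal m₁ m₂ m₃ m₄))
        ≡⟨ cong (λ d → - (+ 8 * indicator d)) (tunnel-free⇒no-diagonal M no-tunnel v) ⟩
      0ℤ
        ≡⟨ sym (weightAt-≡ (_∈ᵇ box a n) v (∈ᵇ-true (inner q∈ n₁)) (∈ᵇ-true (inner q∈ n₂))
                                             (∈ᵇ-true (inner q∈ n₃)) (∈ᵇ-true (inner q∈ n₄))) ⟩
      weightAt (_∈ᵇ box a n) v ∎
    by-contact false untouched with ∨-false⁴ m₁ m₂ m₃ m₄ untouched
    ... | e₁ , e₂ , e₃ , e₄ = begin
      weightAt (_∈ᵇ N) v + weightAt (_∈ᵇ M) v
        ≡⟨ cong₂ _+_ (weightAt-≡ (_∈ᵇ N) v (∈ᵇ-N-outside (∈ᵇ⇒∉ e₁)) (∈ᵇ-N-outside (∈ᵇ⇒∉ e₂))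
                                          (∈ᵇ-N-outside (∈ᵇ⇒∉ e₃)) (∈ᵇ-N-outside (∈ᵇ⇒∉ e₄)))
                     (weightAt-≡ (_∈ᵇ M) v e₁ e₂ e₃ e₄) ⟩
      weightAt (_∈ᵇ box a n) v + 0ℤ
        ≡⟨ ℤ.+-identityʳ _ ⟩
      weightAt (_∈ᵇ box a n) v ∎

  Ê-duality : Ê a n N + Ê a n M ≡ Ê a n (box a n)
  Ê-duality = trans (sym (∑-+ (vertexBox a n) (weightAt (_∈ᵇ N)) (weightAt (_∈ᵇ M))))
                    (∑-cong (vertexBox a n) (λ {v} _ → weight-duality v))

  private
    corner : Pixel
    corner = a , a

    corner∈box : corner ∈ box a n
    corner∈box = ∈-box⁺ a n (here refl) (here refl)

    west-of-corner∉box : (a - 1ℤ , a) ∉ box a n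
    west-of-corner∉box p∈ = below-range a n (i-1<i a) (proj₁ (∈-box⁻ a n p∈))

    corner∉M : corner ∉ M
    corner∉M corner∈ = west-of-corner∉box (inner corner∈ (near-pred a , near-refl a))

    corner∈N : corner ∈ N
    corner∈N = ∈-N⁺ corner∈box corner∉M

    corner-outer : ¬ Finite (Conn1c M corner)
    corner-outer finite = outside-box-infinite a n M⊆box west-of-corner∉box
      (finite-along (step corner∉M (adj1-left a a) (single (λ m∈ → west-of-corner∉box (M⊆box m∈)))) finite)

    N-path⇒complement-path : ∀ {u v} → Conn0 N u v → Conn1c M u v
    N-path⇒complement-path p = path0⇒path1 (no-tunnel⇒bridged-complement M no-tunnel) (path-mono (λ _ → N∌M) p)

    hole⇒N : ∀ {h} → InFiniteHole M h → h ∈ N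
    hole⇒N (h∉M , finite) = ∈-N⁺ (finite-component-in-box a n M⊆box finite) h∉M

  holes⇒components-of-N : ∀ {H T} → Transversal (InFiniteHole M) (Conn1c M) H → Transversal (InM N) (Conn0 N) T →
                          suc (length H) ℕ.≤ length T
  holes⇒components-of-N {H} {T} tH tT =
    injective-relation⇒length≤ (Conn0 N) (corner ∷ H) T (corner∉H ∷ H.unique) T.unique total injective
    where
    module H = Representatives tH
    module T = Representatives tT
    corner∉H : All (corner ≢_) H
    corner∉H = All.tabulate λ { h∈ refl → corner-outer (proj₂ (H.member h∈)) }
    in-N : ∀ {z} → z ∈ corner ∷ H → z ∈ N
    in-N (here refl) = corner∈N
    in-N (there h∈) = hole⇒N (H.member h∈)
    total : ∀ {z} → z ∈ corner ∷ H → DoubleNegation (∃ λ t → t ∈ T × Conn0 N z t)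
    total z∈ = pure (T.representative (in-N z∈))
    apart-from-corner : ∀ {h} → h ∈ H → ¬ Conn1c M h corner
    apart-from-corner h∈ h~corner = corner-outer (finite-along h~corner (proj₂ (H.member h∈)))
    injective : ∀ {z z′ t} → z ∈ corner ∷ H → z′ ∈ corner ∷ H → Conn0 N z t → Conn0 N z′ t → z ≡ z′
    injective z∈ z′∈ z~t z′~t with N-path⇒complement-path (z~t ++ᵖ conn0-sym z′~t)
    injective (here refl) (here refl) _ _ | _ = refl
    injective (here refl) (there h∈) _ _ | corner~h = contradiction (conn1-sym corner~h) (apart-from-corner h∈)
    injective (there h∈) (here refl) _ _ | h~corner = contradiction h~corner (apart-from-corner h∈)
    injective (there h∈) (there h′∈) _ _ | h~h′ = H.identify h∈ h′∈ h~h′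

  holes-of-N⇒components : ∀ {C K} → Transversal (InM M) (Conn0 M) C → Transversal (InFiniteHole N) (Conn1c N) K →
                          length K ℕ.≤ length C
  holes-of-N⇒components {C} {K} tC tK =
    injective-relation⇒length≤ (Conn1c N) K C K.unique C.unique total
      (λ s∈ s′∈ s~r s′~r → K.identify s∈ s′∈ (s~r ++ᵖ conn1-sym s′~r))
    where
    module C = Representatives tC
    module K = Representatives tK
    in-M : ∀ {s} → InFiniteHole N s → s ∈ M
    in-M {s} (s∉N , finite) with s ∈? M
    ... | yes s∈M = s∈M
    ... | no s∉M = contradiction (∈-N⁺ (finite-component-in-box a n N⊆box finite) s∉M) s∉N
    total : ∀ {s} → s ∈ K → DoubleNegation (∃ λ r → r ∈ C × Conn1c N s r)
    total s∈ with C.representative (in-M (K.member s∈))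
    ... | r , r∈ , s~r =
      pure (r , r∈ , path-mono (λ _ m∈ m∈N → N∌M m∈N m∈) (path0⇒path1 (no-tunnel⇒bridged M no-tunnel) s~r))

Bounded : List Pixel → ℤ → ℤ → Set
Bounded M lo hi = ∀ {m} → m ∈ M → (lo ≤ proj₁ m × proj₁ m ≤ hi) × (lo ≤ proj₂ m × proj₂ m ≤ hi)

bounds-exist : ∀ M → ∃ λ lo → ∃ λ hi → lo ≤ hi × Bounded M lo hi
bounds-exist [] = 0ℤ , 0ℤ , ℤ.≤-refl , λ ()
bounds-exist ((x , y) ∷ M) with bounds-exist M
... | lo , hi , lo≤hi , bounded =
  lo ⊓ (x ⊓ y) , hi ⊔ (x ⊔ y) , ℤ.≤-trans (ℤ.i⊓j≤i lo _) (ℤ.≤-trans lo≤hi (ℤ.i≤i⊔j hi _)) , bounded′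
  where
  bounded′ : Bounded ((x , y) ∷ M) (lo ⊓ (x ⊓ y)) (hi ⊔ (x ⊔ y))
  bounded′ (here refl) = (ℤ.≤-trans (ℤ.i⊓j≤j lo _) (ℤ.i⊓j≤i x y) , ℤ.≤-trans (ℤ.i≤i⊔j x y) (ℤ.i≤j⊔i hi _))
                       , (ℤ.≤-trans (ℤ.i⊓j≤j lo _) (ℤ.i⊓j≤j x y) , ℤ.≤-trans (ℤ.i≤j⊔i x y) (ℤ.i≤j⊔i hi _))
  bounded′ (there m∈) with bounded m∈
  ... | (l₁ , u₁) , (l₂ , u₂) = (ℤ.≤-trans (ℤ.i⊓j≤i lo _) l₁ , ℤ.≤-trans u₁ (ℤ.i≤i⊔j hi _))
                              , (ℤ.≤-trans (ℤ.i⊓j≤i lo _) l₂ , ℤ.≤-trans u₂ (ℤ.i≤i⊔j hi _))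

range-between : ∀ a n {t} → a ≤ t → t < a + + n → t ∈ range a n
range-between a n {t} a≤t t<a+n with range-classify a n t
... | inj₁ t<a = contradiction t<a (ℤ.≤⇒≯ a≤t)
... | inj₂ (inj₁ t∈) = t∈
... | inj₂ (inj₂ a+n≤t) = contradiction t<a+n (ℤ.≤⇒≯ a+n≤t)

near-bounds : ∀ {t t′} → Near t t′ → t - 1ℤ ≤ t′ × t′ ≤ t + 1ℤ
near-bounds {t} (inj₁ refl) = ℤ.≤-refl , ℤ.<⇒≤ (ℤ.<-trans (i-1<i t) (i<i+1 t))
near-bounds {t} (inj₂ (inj₁ refl)) = ℤ.<⇒≤ (i-1<i t) , ℤ.<⇒≤ (i<i+1 t)
near-bounds {t} (inj₂ (inj₂ refl)) = ℤ.<⇒≤ (ℤ.<-trans (i-1<i t) (i<i+1 t)) , ℤ.≤-refl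

margin-box : ∀ M → ∃ λ a → ∃ λ n₀ → ∀ {m} → m ∈ M → ∀ {p} → NearPixel m p → p ∈ box a (suc n₀)
margin-box M with bounds-exist M
... | lo , hi , lo≤hi , bounded with ≤⇒offset lo≤hi
...   | d , hi≡lo+d = lo - 1ℤ , suc (suc d) , λ m∈ {p} near → ∈-box⁺ (lo - 1ℤ) (suc (suc (suc d)))
  (widen (proj₁ (bounded m∈)) (proj₁ near)) (widen (proj₂ (bounded m∈)) (proj₂ near))
  where
  widen : ∀ {t t′} → lo ≤ t × t ≤ hi → Near t t′ → t′ ∈ range (lo - 1ℤ) (suc (suc (suc d)))
  widen (lo≤t , t≤hi) near with near-bounds near
  ... | t-1≤t′ , t′≤t+1 = range-between (lo - 1ℤ) _ (ℤ.≤-trans (ℤ.+-monoˡ-≤ -1ℤ lo≤t) t-1≤t′)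
    (ℤ.≤-<-trans t′≤t+1 (ℤ.≤-<-trans (ℤ.+-monoˡ-≤ 1ℤ t≤hi)
      (subst (hi + 1ℤ <_) (trans (cong (λ h → h + 1ℤ + 1ℤ) hi≡lo+d)
                                 (solve 2 (λ lo d → lo :+ d :+ con 1ℤ :+ con 1ℤ := lo :- con 1ℤ :+ (con (+ 3) :+ d))
                                          refl lo (+ d)))
             (i<i+1 (hi + 1ℤ)))))

upper-bound-from-complement : ∀ {c h t k : ℕ} {E-M E-N : ℤ} → + 8 * (+ t - + k) ≤ E-N → suc h ℕ.≤ t → k ℕ.≤ c →
                              E-N + E-M ≡ + 8 → E-M ≤ + 8 * (+ c - + h)
upper-bound-from-complement {c} {h} {t} {k} {E-M} {E-N} lower-N h<t k≤c duality = begin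
  E-M                          ≡⟨ solve 2 (λ m n → m := (n :+ m) :- n) refl E-M E-N ⟩
  E-N + E-M - E-N              ≡⟨ cong (_- E-N) duality ⟩
  + 8 - E-N                    ≤⟨ ℤ.+-monoʳ-≤ (+ 8) (ℤ.neg-mono-≤ (ℤ.≤-trans fewer lower-N)) ⟩
  + 8 - + 8 * (+ suc h - + c)  ≡⟨ solve 2 (λ h c → con (+ 8) :- con (+ 8) :* ((con 1ℤ :+ h) :- c) := con (+ 8) :* (c :- h))
                                        refl (+ h) (+ c) ⟩
  + 8 * (+ c - + h)            ∎
  where
  open ℤ.≤-Reasoning
  fewer : + 8 * (+ suc h - + c) ≤ + 8 * (+ t - + k)
  fewer = ℤ.*-monoˡ-≤-nonNeg (+ 8) (ℤ.+-mono-≤ (+≤+ h<t) (ℤ.neg-mono-≤ (+≤+ k≤c)))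

euler-arithmetic : ∀ {v p b c h : ℕ} {E-M : ℤ} → E-M ≡ + 8 * (+ c - + h) → E-M ≡ + 4 * (+ v - + 2 * + p + + b) →
                   + v - + 2 * (+ p + + c - + h) + + b ≡ 0ℤ
euler-arithmetic {v} {p} {b} {c} {h} {E-M} euler tunnel-free = ℤ.*-cancelˡ-≡ (+ 4) _ 0ℤ (begin
  + 4 * (+ v - + 2 * (+ p + + c - + h) + + b)
    ≡⟨ solve 5 (λ v p c h b → con (+ 4) :* (v :- con (+ 2) :* (p :+ c :- h) :+ b)
                             := con (+ 4) :* (v :- con (+ 2) :* p :+ b) :- con (+ 8) :* (c :- h))
             refl (+ v) (+ p) (+ c) (+ h) (+ b) ⟩
  + 4 * (+ v - + 2 * + p + + b) - + 8 * (+ c - + h)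
    ≡⟨ cong (_- + 8 * (+ c - + h)) (trans (sym tunnel-free) euler) ⟩
  + 8 * (+ c - + h) - + 8 * (+ c - + h)
    ≡⟨ ℤ.+-inverseʳ (+ 8 * (+ c - + h)) ⟩
  0ℤ ∎)
  where open ≡-Reasoning

corollary1 : (M : List Pixel) → Unique M → M ≢ []
    → (∀ w → ¬ IsZeroTunnel M w)
    → (V : List GridPoint) → Enumerates V (IsVertexOfM M)
    → (B : List Pixel) → Enumerates B (Is2Block M)
    → (C : List Pixel) → Transversal (InM M) (Conn0 M) C
    → (H : List Pixel) → Transversal (InFiniteHole M) (Conn1c M) H
    → (+ length V) - (+ 2) * ((+ length M) + (+ length C) - (+ length H)) + (+ length B) ≡ + 0
corollary1 M uM _ no-tunnel V enumV B enumB C tC H tH with margin-box M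
... | a , n₀ , inner = decidable-stable (_ ℤ.≟ _) do
  T , tT ← components-exist N
  K , tK ← holes-exist N a (suc n₀) N⊆box
  let lower = Ê-lower-bound a (suc n₀) M uM M⊆box tC tH
      upper = upper-bound-from-complement {length C} {length H} {length T} {length K}
                (Ê-lower-bound a (suc n₀) N unique-N N⊆box tT tK)
                (holes⇒components-of-N tH tT) (holes-of-N⇒components tC tK) (trans Ê-duality (Ê-box a n₀))
  pure (euler-arithmetic {length V} {length M} {length B} {length C} {length H}
          (ℤ.≤-antisym upper lower) (Ê-tunnel-free M a (suc n₀) M⊆box uM no-tunnel V enumV B enumB))
  where
  open Complement M a n₀ inner no-tunnel
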